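{- Let $\Sigma$ be a signed graph and $L$ a list-assignment of $\Sigma$. Then $$P(\Sigma,L)=\sum_{F\subseteq E(\Sigma)}(-1)^{|F|}\,\gamma(\langle F\rangle,L)\prod_{j=1}^{b(F)}\beta(T_j,L),$$ where $T_1,\ldots,T_{b(F)}$ are all the balanced components of $\langle F\rangle$ (an empty product equals $1$).
   Context: A signed graph $\Sigma=(G,\sigma)$ is a finite graph with $\sigma:E(G)\to\{ -1,1\}$; an edge is negative if its sign is $-1$. A cycle is unbalanced if it has an odd number of negative edges, balanced otherwise; a connected signed graph is unbalanced if it contains an unbalanced cycle and balanced otherwise (isolated vertices are balanced components). A list-assignment $L$ assigns to each vertex $v$ a nonempty set $L(v)\subseteq\mathbb{Z}$; an $L$-coloring is a map $c$ with $c(v)\in L(v)$ for all $v$ and $c(u)\neq\sigma(e)c(v)$ for every edge $e=uv$, and $P(\Sigma,L)$ is the number of $L$-colorings. For $F\subseteq E(\Sigma)$, $\langle F\rangle$ is the spanning subgraph of $\Sigma$ with edge set $F$ (with inherited signs) and $b(F)$ is the number of balanced components of $\langle F\rangle$. For a balanced component $T$, let $V(T)=X_1\cup X_2$ be a partition such that the edges of $T$ between $X_1$ and $X_2$ are exactly the negative edges of $T$, and let $L_1(v)=-L(v)=\{ -a:a\in L(v)\}$ for $v\in X_1$ and $L_1(v)=L(v)$ otherwise; define $\beta(T,L)=|\bigcap_{v\in V(T)}L_1(v)|$ (this does not depend on the choice between the two parts). For a signed graph $\Sigma'$ on vertex set $V(\Sigma)$, $\gamma(\Sigma',L)=0$ if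 some vertex $v$ lying in an unbalanced component of $\Sigma'$ has $0\notin L(v)$, and $\gamma(\Sigma',L)=1$ otherwise. -}

module Defs where

open import Data.Nat as ℕ using (ℕ; zero; suc)
open import Data.Integer as ℤ using (ℤ; +_; -_)
open import Data.Fin as Fin using (Fin)
open import Data.Bool using (Bool; true; false; _∧_; _∨_; not; if_then_else_; _xor_)
open import Data.List using (List; []; _∷_; [_]; map; concatMap; allFin; foldr; length; reverse)
open import Data.Bool.ListAction using (all; any)
open import Data.Maybe using (Maybe; just; nothing)
import Data.Maybe as Maybe
open import Data.Product using (_×_; _,_)
open import Data.Vec as Vec using (Vec)
open import Data.Vec.Functional using () renaming ([] to []ᶠ; _∷_ to _∷ᶠ_)
open import Relation.Nullary.Decidable using (⌊_⌋)

-- Signed graphs: vertex set Fin n, edge set Fin m (loops and parallel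
-- edges allowed), each edge has a pair of endpoints and a sign.

data Sign : Set where
  pos neg : Sign

record SignedGraph (n m : ℕ) : Set where
  field
    ends : Fin m → Fin n × Fin n
    sign : Fin m → Sign
open SignedGraph public

act : Sign → ℤ → ℤ
act pos a = a
act neg a = - a

isNeg : Sign → Bool
isNeg pos = false
isNeg neg = true

_==ᶠ_ : ∀ {k} → Fin k → Fin k → Bool
x ==ᶠ y = ⌊ x Fin.≟ y ⌋

_==ℤ_ : ℤ → ℤ → Bool
x ==ℤ y = ⌊ x ℤ.≟ y ⌋

_∈ℤ_ : ℤ → List ℤ → Bool
a ∈ℤ xs = any (λ b → a ==ℤ b) xs

count : ∀ {A : Set} → (A → Bool) → List A → ℕ
count p [] = 0
count p (x ∷ xs) = if p x then suc (count p xs) else count p xs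

distinct : ∀ {k} → List (Fin k) → Bool
distinct [] = true
distinct (x ∷ xs) = not (any (λ y → x ==ᶠ y) xs) ∧ distinct xs

last? : ∀ {A : Set} → List A → Maybe A
last? [] = nothing
last? (x ∷ []) = just x
last? (x ∷ y ∷ xs) = last? (y ∷ xs)

first : ∀ {A : Set} → (A → Bool) → List A → Maybe A
first p [] = nothing
first p (x ∷ xs) = if p x then just x else first p xs

sumℤ : List ℤ → ℤ
sumℤ = foldr ℤ._+_ (+ 0)

prodℤ : List ℤ → ℤ
prodℤ = foldr ℤ._*_ (+ 1)

allSubsets : ∀ k → List (Vec Bool k)
allSubsets zero = [ Vec.[] ]
allSubsets (suc k) = concatMap (λ b → map (b Vec.∷_) (allSubsets k)) (true ∷ false ∷ [])

seqs : ∀ {m} → ℕ → List (List (Fin m))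
seqs zero = [ [] ]
seqs {m} (suc k) = concatMap (λ e → map (e ∷_) (seqs k)) (allFin m)

seqsUpTo : ∀ {m} → ℕ → List (List (Fin m))
seqsUpTo zero = []
seqsUpTo (suc k) = seqs (suc k) Data.List.++ seqsUpTo k

-- all maps c with c v ∈ L v (one per choice of list elements)
assignments : ∀ n → (Fin n → List ℤ) → List (Fin n → ℤ)
assignments zero L = [ []ᶠ ]
assignments (suc n) L =
  concatMap (λ a → map (λ c → a ∷ᶠ c) (assignments n (λ i → L (Fin.suc i)))) (L Fin.zero)

proper : ∀ {n m} → SignedGraph n m → (Fin n → ℤ) → Bool
proper {n} {m} Σ c =
  all (λ e → let (u , v) = ends Σ e in not (c u ==ℤ act (sign Σ e) (c v))) (allFin m)

P : ∀ {n m} → SignedGraph n m → (Fin n → List ℤ) → ℕ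
P {n} Σ L = count (proper Σ) (assignments n L)

-- The spanning subgraph ⟨F⟩ for F ⊆ E(Σ), given as Vec Bool m.

module Spanning {n m : ℕ} (Σ : SignedGraph n m) (F : Vec Bool m) where

  inF : Fin m → Bool
  inF e = Vec.lookup F e

  adj : Fin n → Fin n → Bool
  adj u v = any (λ e → inF e ∧ (let (x , y) = ends Σ e in
                     ((x ==ᶠ u) ∧ (y ==ᶠ v)) ∨ ((x ==ᶠ v) ∧ (y ==ᶠ u)))) (allFin m)

  reach : ℕ → Fin n → Fin n → Bool
  reach zero u v = u ==ᶠ v
  reach (suc k) u v = reach k u v ∨ any (λ w → reach k u w ∧ adj w v) (allFin n)

  -- u and v lie in the same component of ⟨F⟩ (paths have length < n)
  conn : Fin n → Fin n → Bool
  conn u v = reach n u v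

  step : Fin n → Fin m → Maybe (Fin n)
  step v e with ends Σ e
  ... | (x , y) = if x ==ᶠ v then just y else (if y ==ᶠ v then just x else nothing)

  -- vertices v₁ … v_k visited when traversing e₁ … e_k from v₀
  trail : Fin n → List (Fin m) → Maybe (List (Fin n))
  trail v [] = just []
  trail v (e ∷ es) with step v e
  ... | nothing = nothing
  ... | just w = Maybe.map (w ∷_) (trail w es)

  -- v₀ e₁ v₁ … e_k v_k = v₀ is a cycle of ⟨F⟩: k ≥ 1, edges in F,
  -- edges distinct, v₁ … v_k distinct (so v₀ … v_{k-1} distinct), v_k = v₀
  isCycle : Fin n → List (Fin m) → Bool
  isCycle v₀ [] = false
  isCycle v₀ es@(_ ∷ _) with trail v₀ es
  ... | nothing = false
  ... | just vs = all inF es ∧ distinct es ∧ distinct vs ∧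
                  (Maybe.maybe (λ w → w ==ᶠ v₀) false (last? vs))

  oddNeg : List (Fin m) → Bool
  oddNeg es = foldr (λ e b → isNeg (sign Σ e) xor b) false es

  -- the component of ⟨F⟩ containing u contains an unbalanced cycle
  -- (cycles have at most m edges, as their edges are distinct)
  unbalancedAt : Fin n → Bool
  unbalancedAt u = any (λ v₀ → conn u v₀ ∧
                     any (λ es → isCycle v₀ es ∧ oddNeg es) (seqsUpTo m)) (allFin n)

  -- r is the least vertex of its component (one representative per component)
  isRep : Fin n → Bool
  isRep r = all (λ w → not ((Fin.toℕ w ℕ.<ᵇ Fin.toℕ r) ∧ conn w r)) (allFin n)

  -- X is a valid X₁ for the component T of r: the edges of T between
  -- X and its complement are exactly the negative edges of T
  validPart : Fin n → Vec Bool n → Bool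
  validPart r X = all (λ e → let (x , y) = ends Σ e in
                    not (inF e ∧ conn r x ∧ conn r y) ∨
                    ((Vec.lookup X x xor Vec.lookup X y) ==ᵇ isNeg (sign Σ e))) (allFin m)
    where
    _==ᵇ_ : Bool → Bool → Bool
    a ==ᵇ b = not (a xor b)

  -- β(T, L) for the component T of r (meaningful when T is balanced;
  -- the choice of partition does not matter)
  β : Fin n → (Fin n → List ℤ) → ℕ
  β r L with first (validPart r) (allSubsets n)
  ... | nothing = 0
  ... | just X = count (λ a → all (λ v → not (conn r v) ∨ (a ∈ℤ L₁ v)) (allFin n)) (L₁ r)
    where
    L₁ : Fin n → List ℤ
    L₁ v = if Vec.lookup X v then map -_ (L v) else L v

  γ : (Fin n → List ℤ) → ℤ
  γ L = if all (λ v → not (unbalancedAt v) ∨ ((+ 0) ∈ℤ L v)) (allFin n) then + 1 else + 0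

  prodβ : (Fin n → List ℤ) → ℤ
  prodβ L = prodℤ (map (λ r → if isRep r ∧ not (unbalancedAt r) then + β r L else + 1) (allFin n))

  size : ℕ
  size = count (λ b → b) (Vec.toList F)

signPow : ℕ → ℤ
signPow zero = + 1
signPow (suc k) = ℤ.- (signPow k)

expansion : ∀ {n m} → SignedGraph n m → (Fin n → List ℤ) → ℤ
expansion {n} {m} Σ L =
  sumℤ (map (λ F → let open Spanning Σ F in signPow size ℤ.* (γ L ℤ.* prodβ L)) (allSubsets m))

-- Inclusion–exclusion over the edges writes P(Σ, L) as Σ_F (-1)^|F| N(F), where N(F) counts the
-- L-assignments with c(u) = σ(e) c(v) on every edge of F. Along a walk of ⟨F⟩ such an assignment
-- changes by the sign of the walk, so an odd closed walk forces c = -c = 0 on an unbalanced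
-- component (the factor γ), while on a balanced component T the value at one vertex r determines
-- c(v) = ±c(r) through the switching set X₁, the admissible values of c(r) being those of ⋂ L₁(v),
-- i.e. β(T, L). N(F) is computed by pinning every vertex to 0, leaving it free, or linking it to the
-- least vertex of its component, and counting the assignments meeting such a specification
-- vertex by vertex.
module Submission where

open import Defs
import Algebra.Properties.CommutativeSemigroup as CommSemigroupProperties
open import Data.Bool using (Bool; true; false; _∧_; _∨_; not; if_then_else_; _xor_; T)
open import Data.Bool.ListAction using (all; any)
open import Data.Bool.Properties using (xor-assoc; xor-comm; xor-same; xor-identityʳ; not-distribʳ-xor; ∧-zeroʳ; if-float)
open import Data.Empty using (⊥-elim)
open import Data.Fin as Fin using (Fin; zero; suc)
import Data.Fin.Properties as FinP
open import Data.Integer as ℤ using (ℤ; +_; -_) renaming (_+_ to _+ℤ_; _*_ to _*ℤ_)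
import Data.Integer.Properties as ℤP
open import Data.List as List using (List; []; _∷_; map; concatMap; allFin; foldr; length; _++_; tabulate)
open import Data.List.Membership.Propositional using (_∈_; _∉_)
open import Data.List.Membership.Propositional.Properties using (∈-allFin; ∈-map⁺; ∈-++⁺ˡ; ∈-++⁺ʳ; ∈-concat⁺′; ∈-lookup)
import Data.List.Membership.DecPropositional as DecMembership
open import Data.List.Properties using (map-tabulate; map-cong; map-∘; ++-identityʳ)
open import Data.List.Relation.Unary.All as All using (All; []; _∷_)
open import Data.List.Relation.Unary.All.Properties using (¬Any⇒All¬)
open import Data.List.Relation.Unary.AllPairs using ([]; _∷_)
open import Data.List.Relation.Unary.Any using (here; there)
open import Data.List.Relation.Unary.Unique.Propositional using (Unique)
open import Data.Maybe as Maybe using (Maybe; just; nothing)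
open import Data.Maybe.Properties using (just-injective)
open import Data.Nat as ℕ using (ℕ; zero; suc; _+_; _*_; _≤_; _<_; z≤n; s≤s)
open import Data.Nat.ListAction using (sum; product)
import Data.Nat.Properties as ℕP
open import Data.Product using (_×_; _,_; proj₁; proj₂; Σ-syntax; ∃-syntax)
open import Data.Sum as Sum using (_⊎_; inj₁; inj₂)
open import Data.Vec as Vec using (Vec)
open import Data.Vec.Functional using () renaming (_∷_ to _∷ᶠ_)
import Data.Vec.Properties as VecP
open import Function using (_∘_; id)
open import Relation.Nullary using (Dec; yes; no)
open import Relation.Binary.PropositionalEquality

false≢true : false ≢ true
false≢true ()

T⇒≡true : ∀ {b} → T b → b ≡ true
T⇒≡true {true} _ = refl

≡true⇒T : ∀ {b} → b ≡ true → T b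
≡true⇒T refl = _

∧-true⁻ : ∀ {a b} → a ∧ b ≡ true → a ≡ true × b ≡ true
∧-true⁻ {true} {true} _ = refl , refl

∧-true⁺ : ∀ {a b} → a ≡ true → b ≡ true → a ∧ b ≡ true
∧-true⁺ refl refl = refl

∨-true⁻ : ∀ {a b} → a ∨ b ≡ true → a ≡ true ⊎ b ≡ true
∨-true⁻ {true} _ = inj₁ refl
∨-true⁻ {false} e = inj₂ e

∨-trueˡ : ∀ {a} b → a ≡ true → a ∨ b ≡ true
∨-trueˡ b refl = refl

∨-trueʳ : ∀ a {b} → b ≡ true → a ∨ b ≡ true
∨-trueʳ true _ = refl
∨-trueʳ false e = e

implication-true : ∀ {a b} → not a ∨ b ≡ true → a ≡ true → b ≡ true
implication-true h refl = h

true⇔true⇒≡ : ∀ {a b : Bool} → (a ≡ true → b ≡ true) → (b ≡ true → a ≡ true) → a ≡ b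
true⇔true⇒≡ {false} {false} f g = refl
true⇔true⇒≡ {false} {true} f g = g refl
true⇔true⇒≡ {true} {false} f g = sym (f refl)
true⇔true⇒≡ {true} {true} f g = refl

xor-lcomm : ∀ a b c → a xor (b xor c) ≡ b xor (a xor c)
xor-lcomm false b c = refl
xor-lcomm true b c = not-distribʳ-xor b c

xor-cancelˡ : ∀ a b → a xor (a xor b) ≡ b
xor-cancelˡ a b = trans (sym (xor-assoc a a b)) (cong (_xor b) (xor-same a))

xor-telescope : ∀ a b c → (a xor b) xor (b xor c) ≡ a xor c
xor-telescope a b c = trans (xor-assoc a b (b xor c)) (cong (a xor_) (xor-cancelˡ b c))

not-xor-true⇒≡ : ∀ a b → not (a xor b) ≡ true → a ≡ b
not-xor-true⇒≡ true true _ = refl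
not-xor-true⇒≡ false false _ = refl

==ℤ-complete : ∀ {x y : ℤ} → x ≡ y → x ==ℤ y ≡ true
==ℤ-complete {x} refl with x ℤ.≟ x
... | yes _ = refl
... | no x≢x = ⊥-elim (x≢x refl)

==ℤ-≢ : ∀ {x y : ℤ} → x ≢ y → x ==ℤ y ≡ false
==ℤ-≢ {x} {y} x≢y with x ℤ.≟ y
... | yes x≡y = ⊥-elim (x≢y x≡y)
... | no _ = refl

==ℤ-sound : ∀ {x y : ℤ} → x ==ℤ y ≡ true → x ≡ y
==ℤ-sound {x} {y} _ with x ℤ.≟ y
... | yes x≡y = x≡y

==ᶠ-complete : ∀ {k} {x y : Fin k} → x ≡ y → x ==ᶠ y ≡ true
==ᶠ-complete {x = x} refl with x Fin.≟ x
... | yes _ = refl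
... | no x≢x = ⊥-elim (x≢x refl)

==ᶠ-≢ : ∀ {k} {x y : Fin k} → x ≢ y → x ==ᶠ y ≡ false
==ᶠ-≢ {x = x} {y} x≢y with x Fin.≟ y
... | yes x≡y = ⊥-elim (x≢y x≡y)
... | no _ = refl

==ᶠ-sound : ∀ {k} {x y : Fin k} → x ==ᶠ y ≡ true → x ≡ y
==ᶠ-sound {x = x} {y} _ with x Fin.≟ y
... | yes x≡y = x≡y

==ᶠ-suc : ∀ {k} (x y : Fin k) → (suc x ==ᶠ suc y) ≡ (x ==ᶠ y)
==ᶠ-suc x y with x Fin.≟ y
... | yes refl = refl
... | no _ = refl

any-true⁻ : ∀ {A : Set} (p : A → Bool) xs → any p xs ≡ true → ∃[ x ] (x ∈ xs × p x ≡ true)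
any-true⁻ p (x ∷ xs) e with ∨-true⁻ {p x} e
... | inj₁ px = x , here refl , px
... | inj₂ r with any-true⁻ p xs r
...   | y , y∈xs , py = y , there y∈xs , py

any-true⁺ : ∀ {A : Set} (p : A → Bool) {x xs} → x ∈ xs → p x ≡ true → any p xs ≡ true
any-true⁺ p {xs = y ∷ ys} (here refl) px = ∨-trueˡ (any p ys) px
any-true⁺ p {xs = y ∷ ys} (there x∈ys) px = ∨-trueʳ (p y) (any-true⁺ p x∈ys px)

any-false⁺ : ∀ {A : Set} (p : A → Bool) xs → (∀ x → x ∈ xs → p x ≡ false) → any p xs ≡ false
any-false⁺ p [] h = refl
any-false⁺ p (x ∷ xs) h rewrite h x (here refl) = any-false⁺ p xs (λ y y∈xs → h y (there y∈xs))

all-true⁻ : ∀ {A : Set} (p : A → Bool) {x xs} → all p xs ≡ true → x ∈ xs → p x ≡ true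
all-true⁻ p {xs = y ∷ ys} e (here refl) = proj₁ (∧-true⁻ {p y} e)
all-true⁻ p {xs = y ∷ ys} e (there x∈ys) = all-true⁻ p (proj₂ (∧-true⁻ {p y} e)) x∈ys

all-true⁺ : ∀ {A : Set} (p : A → Bool) xs → (∀ x → x ∈ xs → p x ≡ true) → all p xs ≡ true
all-true⁺ p [] h = refl
all-true⁺ p (x ∷ xs) h = ∧-true⁺ (h x (here refl)) (all-true⁺ p xs (λ y y∈xs → h y (there y∈xs)))

all-false⁺ : ∀ {A : Set} (p : A → Bool) {x xs} → x ∈ xs → p x ≡ false → all p xs ≡ false
all-false⁺ p {xs = y ∷ ys} (here refl) px rewrite px = refl
all-false⁺ p {xs = y ∷ ys} (there x∈ys) px with p y
... | true = all-false⁺ p x∈ys px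
... | false = refl

all-cong : ∀ {A : Set} {p q : A → Bool} → (∀ x → p x ≡ q x) → ∀ xs → all p xs ≡ all q xs
all-cong e xs = cong (foldr _∧_ true) (map-cong e xs)

any-cong : ∀ {A : Set} {p q : A → Bool} → (∀ x → p x ≡ q x) → ∀ xs → any p xs ≡ any q xs
any-cong e xs = cong (foldr _∨_ false) (map-cong e xs)

map-allFin-suc : ∀ {A : Set} n (g : Fin (suc n) → A) →
  map g (allFin (suc n)) ≡ g zero ∷ map (g ∘ suc) (allFin n)
map-allFin-suc n g = begin
    map g (tabulate id)          ≡⟨ map-tabulate id g ⟩
    g zero ∷ tabulate (g ∘ suc)  ≡⟨ cong (g zero ∷_) (map-tabulate id (g ∘ suc)) ⟨
    g zero ∷ map (g ∘ suc) (allFin n) ∎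
  where open ≡-Reasoning

all-allFin-suc : ∀ n (p : Fin (suc n) → Bool) → all p (allFin (suc n)) ≡ p zero ∧ all (p ∘ suc) (allFin n)
all-allFin-suc n p = cong (foldr _∧_ true) (map-allFin-suc n p)

∈-allSubsets : ∀ k (X : Vec Bool k) → X ∈ allSubsets k
∈-allSubsets zero Vec.[] = here refl
∈-allSubsets (suc k) (b Vec.∷ X) =
  ∈-concat⁺′ (∈-map⁺ (b Vec.∷_) (∈-allSubsets k X)) (∈-map⁺ (λ b′ → map (b′ Vec.∷_) (allSubsets k)) (b∈ b))
  where
  b∈ : ∀ b → b ∈ (true ∷ false ∷ [])
  b∈ true = here refl
  b∈ false = there (here refl)

first-complete : ∀ {A : Set} (p : A → Bool) {y} xs → y ∈ xs → p y ≡ true → ∃[ x ] (first p xs ≡ just x × p x ≡ true)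
first-complete p (x ∷ xs) y∈ py with p x in px
... | true = x , refl , px
first-complete p (x ∷ xs) (here refl) py | false = ⊥-elim (false≢true (trans (sym px) py))
first-complete p (x ∷ xs) (there y∈) py | false = first-complete p xs y∈ py

𝟙 : Bool → ℕ
𝟙 true = 1
𝟙 false = 0

𝟙-∧ : ∀ a b → 𝟙 (a ∧ b) ≡ 𝟙 a * 𝟙 b
𝟙-∧ true b = sym (ℕP.+-identityʳ (𝟙 b))
𝟙-∧ false b = refl

count-++ : ∀ {A : Set} (p : A → Bool) xs ys → count p (xs ++ ys) ≡ count p xs + count p ys
count-++ p [] ys = refl
count-++ p (x ∷ xs) ys with p x
... | true = cong suc (count-++ p xs ys)
... | false = count-++ p xs ys

count-map : ∀ {A B : Set} (p : B → Bool) (f : A → B) xs → count p (map f xs) ≡ count (p ∘ f) xs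
count-map p f [] = refl
count-map p f (x ∷ xs) with p (f x)
... | true = cong suc (count-map p f xs)
... | false = count-map p f xs

count-concatMap : ∀ {A B : Set} (p : B → Bool) (f : A → List B) xs →
  count p (concatMap f xs) ≡ sum (map (λ x → count p (f x)) xs)
count-concatMap p f [] = refl
count-concatMap p f (x ∷ xs) =
  trans (count-++ p (f x) (concatMap f xs)) (cong (_+_ (count p (f x))) (count-concatMap p f xs))

count-cong-∈ : ∀ {A : Set} {p q : A → Bool} xs → (∀ x → x ∈ xs → p x ≡ q x) → count p xs ≡ count q xs
count-cong-∈ [] e = refl
count-cong-∈ {q = q} (x ∷ xs) e rewrite e x (here refl) with q x
... | true = cong suc (count-cong-∈ xs (λ y y∈xs → e y (there y∈xs)))
... | false = count-cong-∈ xs (λ y y∈xs → e y (there y∈xs))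

count-cong : ∀ {A : Set} {p q : A → Bool} → (∀ x → p x ≡ q x) → ∀ xs → count p xs ≡ count q xs
count-cong e xs = count-cong-∈ xs (λ x _ → e x)

count-∧ˡ : ∀ {A : Set} (b : Bool) (q : A → Bool) xs → count (λ x → b ∧ q x) xs ≡ 𝟙 b * count q xs
count-∧ˡ true q xs = sym (ℕP.+-identityʳ (count q xs))
count-∧ˡ false q [] = refl
count-∧ˡ false q (x ∷ xs) = count-∧ˡ false q xs

count≡sum-𝟙 : ∀ {A : Set} (p : A → Bool) xs → count p xs ≡ sum (map (𝟙 ∘ p) xs)
count≡sum-𝟙 p [] = refl
count≡sum-𝟙 p (x ∷ xs) with p x
... | true = cong suc (count≡sum-𝟙 p xs)
... | false = count≡sum-𝟙 p xs

sum-map-*ʳ : ∀ {A : Set} (f : A → ℕ) K xs → sum (map (λ x → f x * K) xs) ≡ sum (map f xs) * K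
sum-map-*ʳ f K [] = refl
sum-map-*ʳ f K (x ∷ xs) =
  trans (cong (_+_ (f x * K)) (sum-map-*ʳ f K xs)) (sym (ℕP.*-distribʳ-+ K (f x) (sum (map f xs))))

count-*ʳ : ∀ {A : Set} (p : A → Bool) K xs → sum (map (λ x → 𝟙 (p x) * K) xs) ≡ count p xs * K
count-*ʳ p K xs = trans (sum-map-*ʳ (𝟙 ∘ p) K xs) (cong (_* K) (sym (count≡sum-𝟙 p xs)))

product-𝟙-* : ∀ {A : Set} (p : A → Bool) (g : A → ℕ) xs →
  product (map (λ x → 𝟙 (p x) * g x) xs) ≡ 𝟙 (all p xs) * product (map g xs)
product-𝟙-* p g [] = refl
product-𝟙-* p g (x ∷ xs) = begin
    𝟙 (p x) * g x * product (map (λ x → 𝟙 (p x) * g x) xs)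
      ≡⟨ cong (𝟙 (p x) * g x *_) (product-𝟙-* p g xs) ⟩
    𝟙 (p x) * g x * (𝟙 (all p xs) * product (map g xs))
      ≡⟨ CommSemigroupProperties.interchange ℕP.*-commutativeSemigroup (𝟙 (p x)) (g x) _ _ ⟩
    𝟙 (p x) * 𝟙 (all p xs) * (g x * product (map g xs))
      ≡⟨ cong (_* (g x * product (map g xs))) (𝟙-∧ (p x) (all p xs)) ⟨
    𝟙 (p x ∧ all p xs) * (g x * product (map g xs)) ∎
  where open ≡-Reasoning

count-==ℤ-unique : ∀ (z : ℤ) xs → Unique xs → count (λ a → a ==ℤ z) xs ≡ 𝟙 (z ∈ℤ xs)
count-==ℤ-unique z [] _ = refl
count-==ℤ-unique z (x ∷ xs) (x∉xs ∷ u) with x ℤ.≟ z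
... | yes refl rewrite ==ℤ-complete {x} refl = cong suc (count-absent xs x∉xs)
  where
  count-absent : ∀ ys → All (x ≢_) ys → count (λ a → a ==ℤ x) ys ≡ 0
  count-absent [] [] = refl
  count-absent (y ∷ ys) (x≢y ∷ ps) rewrite ==ℤ-≢ (x≢y ∘ sym) = count-absent ys ps
... | no x≢z rewrite ==ℤ-≢ {z} (x≢z ∘ sym) = count-==ℤ-unique z xs u

sumℤ-++ : ∀ {A : Set} (f : A → ℤ) xs ys → sumℤ (map f (xs ++ ys)) ≡ sumℤ (map f xs) +ℤ sumℤ (map f ys)
sumℤ-++ f [] ys = sym (ℤP.+-identityˡ _)
sumℤ-++ f (x ∷ xs) ys = trans (cong (f x +ℤ_) (sumℤ-++ f xs ys)) (sym (ℤP.+-assoc (f x) _ _))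

sumℤ-neg : ∀ {A : Set} (f : A → ℤ) xs → sumℤ (map (λ x → - f x) xs) ≡ - sumℤ (map f xs)
sumℤ-neg f [] = refl
sumℤ-neg f (x ∷ xs) = trans (cong (- f x +ℤ_) (sumℤ-neg f xs)) (sym (ℤP.neg-distrib-+ (f x) _))

sumℤ-0 : ∀ {A : Set} xs → sumℤ (map (λ (_ : A) → + 0) xs) ≡ + 0
sumℤ-0 [] = refl
sumℤ-0 (x ∷ xs) = trans (ℤP.+-identityˡ _) (sumℤ-0 xs)

sumℤ-+ : ∀ {A : Set} (f g : A → ℤ) xs → sumℤ (map (λ x → f x +ℤ g x) xs) ≡ sumℤ (map f xs) +ℤ sumℤ (map g xs)
sumℤ-+ f g [] = refl
sumℤ-+ f g (x ∷ xs) = trans (cong (f x +ℤ g x +ℤ_) (sumℤ-+ f g xs))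
  (CommSemigroupProperties.interchange ℤP.+-commutativeSemigroup (f x) (g x) _ _)

sumℤ-cong : ∀ {A : Set} {f g : A → ℤ} → (∀ x → f x ≡ g x) → ∀ xs → sumℤ (map f xs) ≡ sumℤ (map g xs)
sumℤ-cong e xs = cong sumℤ (map-cong e xs)

+count≡sumℤ : ∀ {A : Set} (p : A → Bool) xs → + count p xs ≡ sumℤ (map (λ x → + 𝟙 (p x)) xs)
+count≡sumℤ p [] = refl
+count≡sumℤ p (x ∷ xs) with p x
... | true = trans (ℤP.pos-+ 1 (count p xs)) (cong (+ 1 +ℤ_) (+count≡sumℤ p xs))
... | false = trans (sym (ℤP.+-identityˡ _)) (cong (+ 0 +ℤ_) (+count≡sumℤ p xs))

-- Inclusion–exclusion over edge sets

card : ∀ {m} → Vec Bool m → ℕ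
card F = count (λ b → b) (Vec.toList F)

_⊆ᵇ_ : ∀ {m} → Vec Bool m → (Fin m → Bool) → Bool
_⊆ᵇ_ {m} F S = all (λ e → not (Vec.lookup F e) ∨ S e) (allFin m)

sumℤ-allSubsets-suc : ∀ m (f : Vec Bool (suc m) → ℤ) →
  sumℤ (map f (allSubsets (suc m))) ≡
  sumℤ (map (f ∘ (true Vec.∷_)) (allSubsets m)) +ℤ sumℤ (map (f ∘ (false Vec.∷_)) (allSubsets m))
sumℤ-allSubsets-suc m f = begin
    sumℤ (map f (map (true Vec.∷_) Fs ++ (map (false Vec.∷_) Fs ++ [])))
      ≡⟨ sumℤ-++ f (map (true Vec.∷_) Fs) _ ⟩
    sumℤ (map f (map (true Vec.∷_) Fs)) +ℤ sumℤ (map f (map (false Vec.∷_) Fs ++ []))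
      ≡⟨ cong (λ t → sumℤ (map f (map (true Vec.∷_) Fs)) +ℤ sumℤ (map f t)) (++-identityʳ (map (false Vec.∷_) Fs)) ⟩
    sumℤ (map f (map (true Vec.∷_) Fs)) +ℤ sumℤ (map f (map (false Vec.∷_) Fs))
      ≡⟨ cong₂ _+ℤ_ (cong sumℤ (map-∘ Fs)) (cong sumℤ (map-∘ Fs)) ⟨
    sumℤ (map (f ∘ (true Vec.∷_)) Fs) +ℤ sumℤ (map (f ∘ (false Vec.∷_)) Fs) ∎
  where
  open ≡-Reasoning
  Fs = allSubsets m

∑-signPow-⊆ : ∀ m (S : Fin m → Bool) →
  sumℤ (map (λ F → signPow (card F) *ℤ + 𝟙 (F ⊆ᵇ S)) (allSubsets m)) ≡ + 𝟙 (all (not ∘ S) (allFin m))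
∑-signPow-⊆ zero S = refl
∑-signPow-⊆ (suc m) S = begin
    sumℤ (map Term (allSubsets (suc m)))
      ≡⟨ sumℤ-allSubsets-suc m Term ⟩
    sumℤ (map (λ F → Term (true Vec.∷ F)) Fs) +ℤ sumℤ (map (λ F → Term (false Vec.∷ F)) Fs)
      ≡⟨ cong₂ _+ℤ_ (sumℤ-cong with-e₀ Fs) (sumℤ-cong without-e₀ Fs) ⟩
    sumℤ (map (λ F → - (signPow (card F) *ℤ + 𝟙 (S zero ∧ F ⊆ᵇ (S ∘ suc)))) Fs) +ℤ sumℤ (map Term′ Fs)
      ≡⟨ split-on-e₀ (S zero) ⟩
    + 𝟙 (not (S zero) ∧ all (not ∘ S ∘ suc) (allFin m))
      ≡⟨ cong (+_ ∘ 𝟙) (all-allFin-suc m (not ∘ S)) ⟨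
    + 𝟙 (all (not ∘ S) (allFin (suc m))) ∎
  where
  open ≡-Reasoning
  Fs = allSubsets m
  Term : Vec Bool (suc m) → ℤ
  Term F = signPow (card F) *ℤ + 𝟙 (F ⊆ᵇ S)
  Term′ : Vec Bool m → ℤ
  Term′ F = signPow (card F) *ℤ + 𝟙 (F ⊆ᵇ (S ∘ suc))
  with-e₀ : ∀ F → Term (true Vec.∷ F) ≡ - (signPow (card F) *ℤ + 𝟙 (S zero ∧ F ⊆ᵇ (S ∘ suc)))
  with-e₀ F rewrite all-allFin-suc m (λ e → not (Vec.lookup (true Vec.∷ F) e) ∨ S e) =
    sym (ℤP.neg-distribˡ-* (signPow (card F)) _)
  without-e₀ : ∀ F → Term (false Vec.∷ F) ≡ Term′ F
  without-e₀ F rewrite all-allFin-suc m (λ e → not (Vec.lookup (false Vec.∷ F) e) ∨ S e) = refl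
  -- The terms containing e₀ cancel those without it when S e₀ holds, and vanish otherwise.
  split-on-e₀ : ∀ b →
    sumℤ (map (λ F → - (signPow (card F) *ℤ + 𝟙 (b ∧ F ⊆ᵇ (S ∘ suc)))) Fs) +ℤ sumℤ (map Term′ Fs)
    ≡ + 𝟙 (not b ∧ all (not ∘ S ∘ suc) (allFin m))
  split-on-e₀ true = trans (cong (_+ℤ sumℤ (map Term′ Fs)) (sumℤ-neg Term′ Fs)) (ℤP.+-inverseˡ (sumℤ (map Term′ Fs)))
  split-on-e₀ false = begin
      sumℤ (map (λ F → - (signPow (card F) *ℤ + 0)) Fs) +ℤ sumℤ (map Term′ Fs)
        ≡⟨ cong (_+ℤ sumℤ (map Term′ Fs)) (trans (sumℤ-cong (λ F → cong -_ (ℤP.*-zeroʳ (signPow (card F)))) Fs) (sumℤ-0 Fs)) ⟩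
      + 0 +ℤ sumℤ (map Term′ Fs)
        ≡⟨ ℤP.+-identityˡ _ ⟩
      sumℤ (map Term′ Fs)
        ≡⟨ ∑-signPow-⊆ m (S ∘ suc) ⟩
      + 𝟙 (all (not ∘ S ∘ suc) (allFin m)) ∎

sumℤ-*-count-swap : ∀ {A B : Set} (w : B → ℤ) (p : B → A → Bool) (xs : List A) (Fs : List B) →
  sumℤ (map (λ F → w F *ℤ + count (p F) xs) Fs) ≡ sumℤ (map (λ x → sumℤ (map (λ F → w F *ℤ + 𝟙 (p F x)) Fs)) xs)
sumℤ-*-count-swap w p [] Fs = trans (sumℤ-cong (λ F → ℤP.*-zeroʳ (w F)) Fs) (sumℤ-0 Fs)
sumℤ-*-count-swap w p (x ∷ xs) Fs = begin
    sumℤ (map (λ F → w F *ℤ + count (p F) (x ∷ xs)) Fs)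
      ≡⟨ sumℤ-cong (λ F → trans (cong (w F *ℤ_) (count-∷ (p F))) (ℤP.*-distribˡ-+ (w F) _ _)) Fs ⟩
    sumℤ (map (λ F → w F *ℤ + 𝟙 (p F x) +ℤ w F *ℤ + count (p F) xs) Fs)
      ≡⟨ sumℤ-+ _ _ Fs ⟩
    sumℤ (map (λ F → w F *ℤ + 𝟙 (p F x)) Fs) +ℤ sumℤ (map (λ F → w F *ℤ + count (p F) xs) Fs)
      ≡⟨ cong (sumℤ (map (λ F → w F *ℤ + 𝟙 (p F x)) Fs) +ℤ_) (sumℤ-*-count-swap w p xs Fs) ⟩
    sumℤ (map (λ x → sumℤ (map (λ F → w F *ℤ + 𝟙 (p F x)) Fs)) (x ∷ xs)) ∎
  where
  open ≡-Reasoning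
  count-∷ : (q : _ → Bool) → + count q (x ∷ xs) ≡ + 𝟙 (q x) +ℤ + count q xs
  count-∷ q with q x
  ... | true = refl
  ... | false = refl

module Violations {n m : ℕ} (G : SignedGraph n m) where

  violates : (Fin n → ℤ) → Fin m → Bool
  violates c e = let (u , v) = ends G e in c u ==ℤ act (sign G e) (c v)

  violatesAll : Vec Bool m → (Fin n → ℤ) → Bool
  violatesAll F c = F ⊆ᵇ violates c

  P-inclusion–exclusion : ∀ L →
    + P G L ≡ sumℤ (map (λ F → signPow (card F) *ℤ + count (violatesAll F) (assignments n L)) (allSubsets m))
  P-inclusion–exclusion L = sym (begin
      sumℤ (map (λ F → signPow (card F) *ℤ + count (violatesAll F) A) (allSubsets m))
        ≡⟨ sumℤ-*-count-swap (signPow ∘ card) violatesAll A (allSubsets m) ⟩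
      sumℤ (map (λ c → sumℤ (map (λ F → signPow (card F) *ℤ + 𝟙 (violatesAll F c)) (allSubsets m))) A)
        ≡⟨ sumℤ-cong (λ c → ∑-signPow-⊆ m (violates c)) A ⟩
      sumℤ (map (λ c → + 𝟙 (proper G c)) A)
        ≡⟨ +count≡sumℤ (proper G) A ⟨
      + P G L ∎)
    where
    open ≡-Reasoning
    A = assignments n L

-- Counting assignments that meet a specification

data Spec (n : ℕ) : Set where
  free : Spec n
  const : ℤ → Spec n
  link : Fin n → (ℤ → ℤ) → Spec n

satisfies : ∀ {n} → (Fin n → ℤ) → Fin n → Spec n → Bool
satisfies c v free = true
satisfies c v (const z) = c v ==ℤ z
satisfies c v (link w f) = c v ==ℤ f (c w)

meets : ∀ {n} → (Fin n → Spec n) → (Fin n → ℤ) → Bool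
meets {n} sp c = all (λ v → satisfies c v (sp v)) (allFin n)

LinksToEarlierFree : ∀ {n} → (Fin n → Spec n) → Set
LinksToEarlierFree sp = ∀ v w f → sp v ≡ link w f → sp w ≡ free × w Fin.< v

linkFits : ∀ {n} → (Fin n → List ℤ) → Fin n → ℤ → Fin n → Spec n → Bool
linkFits L r a u free = true
linkFits L r a u (const _) = true
linkFits L r a u (link w f) = not (w ==ᶠ r) ∨ (f a ∈ℤ L u)

freeChoices : ∀ {n} → (Fin n → Spec n) → (Fin n → List ℤ) → Fin n → ℕ
freeChoices {n} sp L r = count (λ a → all (λ u → linkFits L r a u (sp u)) (allFin n)) (L r)

choices : ∀ {n} → (Fin n → Spec n) → (Fin n → List ℤ) → Fin n → Spec n → ℕ
choices sp L v free = freeChoices sp L v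
choices sp L v (const z) = 𝟙 (z ∈ℤ L v)
choices sp L v (link _ _) = 1

choiceCount : ∀ {n} → (Fin n → Spec n) → (Fin n → List ℤ) → ℕ
choiceCount {n} sp L = product (map (λ v → choices sp L v (sp v)) (allFin n))

instantiate₀ : ∀ {n} → ℤ → Spec (suc n) → Spec n
instantiate₀ a free = free
instantiate₀ a (const z) = const z
instantiate₀ a (link zero f) = const (f a)
instantiate₀ a (link (suc w) f) = link w f

instantiate : ∀ {n} → ℤ → (Fin (suc n) → Spec (suc n)) → Fin n → Spec n
instantiate a sp v = instantiate₀ a (sp (suc v))

satisfies-instantiate₀ : ∀ {n} a (c : Fin n → ℤ) v (s : Spec (suc n)) →
  satisfies (a ∷ᶠ c) (suc v) s ≡ satisfies c v (instantiate₀ a s)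
satisfies-instantiate₀ a c v free = refl
satisfies-instantiate₀ a c v (const z) = refl
satisfies-instantiate₀ a c v (link zero f) = refl
satisfies-instantiate₀ a c v (link (suc w) f) = refl

meets-∷ : ∀ {n} (sp : Fin (suc n) → Spec (suc n)) a c →
  meets sp (a ∷ᶠ c) ≡ satisfies (a ∷ᶠ c) zero (sp zero) ∧ meets (instantiate a sp) c
meets-∷ {n} sp a c = trans (all-allFin-suc n (λ v → satisfies (a ∷ᶠ c) v (sp v)))
  (cong (satisfies (a ∷ᶠ c) zero (sp zero) ∧_)
        (all-cong (λ v → satisfies-instantiate₀ a c v (sp (suc v))) (allFin n)))

instantiate₀-link : ∀ {n} a (s : Spec (suc n)) w f → instantiate₀ a s ≡ link w f → s ≡ link (suc w) f
instantiate₀-link a (link (suc _) _) w f refl = refl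

instantiate-LinksToEarlierFree : ∀ {n} a (sp : Fin (suc n) → Spec (suc n)) →
  LinksToEarlierFree sp → LinksToEarlierFree (instantiate a sp)
instantiate-LinksToEarlierFree a sp wf v w f e
  with wf (suc v) (suc w) f (instantiate₀-link a (sp (suc v)) w f e)
... | sp-w-free , s≤s w<v rewrite sp-w-free = refl , w<v

freeChoices-instantiate : ∀ {n} (sp : Fin (suc n) → Spec (suc n)) (L : Fin (suc n) → List ℤ) a v →
  (∀ x → linkFits L (suc v) x zero (sp zero) ≡ true) →
  freeChoices sp L (suc v) ≡ freeChoices (instantiate a sp) (L ∘ suc) v
freeChoices-instantiate {n} sp L a v fits₀ = count-cong fits (L (suc v))
  where
  fits-suc : ∀ x u → linkFits L (suc v) x (suc u) (sp (suc u)) ≡ linkFits (L ∘ suc) v x u (instantiate a sp u)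
  fits-suc x u with sp (suc u)
  ... | free = refl
  ... | const _ = refl
  ... | link zero f = refl
  ... | link (suc w) f = cong (λ t → not t ∨ (f x ∈ℤ L (suc u))) (==ᶠ-suc w v)
  fits : ∀ x → all (λ u → linkFits L (suc v) x u (sp u)) (allFin (suc n)) ≡
               all (λ u → linkFits (L ∘ suc) v x u (instantiate a sp u)) (allFin n)
  fits x rewrite all-allFin-suc n (λ u → linkFits L (suc v) x u (sp u)) | fits₀ x = all-cong (fits-suc x) (allFin n)

-- Vertex 0 is never linked, so fixing its value a and substituting a into the links to 0
-- leaves a specification on the remaining vertices.
module CountStep {n} (L : Fin (suc n) → List ℤ) (sp : Fin (suc n) → Spec (suc n))
  (unique : ∀ v → Unique (L v)) (wf : LinksToEarlierFree sp)
  (IH : ∀ a → count (meets (instantiate a sp)) (assignments n (L ∘ suc)) ≡ choiceCount (instantiate a sp) (L ∘ suc))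
  where

  A′ : List (Fin n → ℤ)
  A′ = assignments n (L ∘ suc)

  rest : ℕ
  rest = product (map (λ v → choices sp L (suc v) (sp (suc v))) (allFin n))

  zero-unlinked : ∀ x v → linkFits L (suc v) x zero (sp zero) ≡ true
  zero-unlinked x v with sp zero in sp₀
  ... | free = refl
  ... | const _ = refl
  ... | link w f with () ← proj₂ (wf zero w f sp₀)

  choiceCount-∷ : choiceCount sp L ≡ choices sp L zero (sp zero) * rest
  choiceCount-∷ = cong product (map-allFin-suc n (λ v → choices sp L v (sp v)))

  count-at₀ : Spec (suc n) → ℕ
  count-at₀ s = sum (map (λ a → count (λ c → satisfies (a ∷ᶠ c) zero s ∧ meets (instantiate a sp) c) A′) (L zero))

  count-meets-const : ∀ z → sp zero ≡ const z → count-at₀ (const z) ≡ choiceCount sp L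
  count-meets-const z sp₀ = begin
      sum (map (λ a → count (λ c → (a ==ℤ z) ∧ meets (instantiate a sp) c) A′) (L zero))
        ≡⟨ cong sum (map-cong (λ a → count-∧ˡ (a ==ℤ z) _ A′) (L zero)) ⟩
      sum (map (λ a → 𝟙 (a ==ℤ z) * count (meets (instantiate a sp)) A′) (L zero))
        ≡⟨ cong sum (map-cong (λ a → cong (𝟙 (a ==ℤ z) *_) (trans (IH a) (unaffected a))) (L zero)) ⟩
      sum (map (λ a → 𝟙 (a ==ℤ z) * rest) (L zero))
        ≡⟨ count-*ʳ (_==ℤ z) rest (L zero) ⟩
      count (_==ℤ z) (L zero) * rest
        ≡⟨ cong (_* rest) (count-==ℤ-unique z (L zero) (unique zero)) ⟩
      𝟙 (z ∈ℤ L zero) * rest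
        ≡⟨ cong (λ s → choices sp L zero s * rest) sp₀ ⟨
      choices sp L zero (sp zero) * rest
        ≡⟨ choiceCount-∷ ⟨
      choiceCount sp L ∎
    where
    open ≡-Reasoning
    same-choices : ∀ a v → choices (instantiate a sp) (L ∘ suc) v (instantiate a sp v) ≡ choices sp L (suc v) (sp (suc v))
    same-choices a v with sp (suc v) in sp-v
    ... | free = sym (freeChoices-instantiate sp L a v (λ x → zero-unlinked x v))
    ... | const _ = refl
    ... | link (suc w) f = refl
    ... | link zero f with trans (sym sp₀) (proj₁ (wf (suc v) zero f sp-v))
    ...   | ()
    unaffected : ∀ a → choiceCount (instantiate a sp) (L ∘ suc) ≡ rest
    unaffected a = cong product (map-cong (same-choices a) (allFin n))

  count-meets-free : sp zero ≡ free → count-at₀ free ≡ choiceCount sp L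
  count-meets-free sp₀ = begin
      sum (map (λ a → count (meets (instantiate a sp)) A′) (L zero))
        ≡⟨ cong sum (map-cong (λ a → trans (IH a) (factor a)) (L zero)) ⟩
      sum (map (λ a → 𝟙 (fitsAll a) * rest) (L zero))
        ≡⟨ count-*ʳ fitsAll rest (L zero) ⟩
      count fitsAll (L zero) * rest
        ≡⟨ cong (_* rest) (count-cong fitsAll-∷ (L zero)) ⟩
      freeChoices sp L zero * rest
        ≡⟨ cong (λ s → choices sp L zero s * rest) sp₀ ⟨
      choices sp L zero (sp zero) * rest
        ≡⟨ choiceCount-∷ ⟨
      choiceCount sp L ∎
    where
    open ≡-Reasoning
    fits : ℤ → Fin n → Bool
    fits a v = linkFits L zero a (suc v) (sp (suc v))
    fitsAll : ℤ → Bool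
    fitsAll a = all (fits a) (allFin n)
    fitsAll-∷ : ∀ a → fitsAll a ≡ all (λ u → linkFits L zero a u (sp u)) (allFin (suc n))
    fitsAll-∷ a rewrite all-allFin-suc n (λ u → linkFits L zero a u (sp u)) | sp₀ = refl
    gated-choices : ∀ a v → choices (instantiate a sp) (L ∘ suc) v (instantiate a sp v) ≡ 𝟙 (fits a v) * choices sp L (suc v) (sp (suc v))
    gated-choices a v with sp (suc v) in sp-v
    ... | free = trans (sym (freeChoices-instantiate sp L a v (λ x → zero-unlinked x v)))
                       (sym (ℕP.+-identityʳ _))
    ... | const _ = sym (ℕP.+-identityʳ _)
    ... | link (suc w) f = refl
    ... | link zero f = sym (ℕP.*-identityʳ _)
    factor : ∀ a → choiceCount (instantiate a sp) (L ∘ suc) ≡ 𝟙 (fitsAll a) * rest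
    factor a = trans (cong product (map-cong (gated-choices a) (allFin n)))
      (product-𝟙-* (fits a) (λ v → choices sp L (suc v) (sp (suc v))) (allFin n))

  count-meets-∷ : count (meets sp) (assignments (suc n) L) ≡ count-at₀ (sp zero)
  count-meets-∷ = begin
      count (meets sp) (assignments (suc n) L)
        ≡⟨ count-concatMap (meets sp) (λ a → map (a ∷ᶠ_) A′) (L zero) ⟩
      sum (map (λ a → count (meets sp) (map (a ∷ᶠ_) A′)) (L zero))
        ≡⟨ cong sum (map-cong (λ a → trans (count-map (meets sp) (a ∷ᶠ_) A′) (count-cong (meets-∷ sp a) A′)) (L zero)) ⟩
      count-at₀ (sp zero) ∎
    where open ≡-Reasoning

count-meets : ∀ n (L : Fin n → List ℤ) (sp : Fin n → Spec n) → (∀ v → Unique (L v)) → LinksToEarlierFree sp →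
  count (meets sp) (assignments n L) ≡ choiceCount sp L
count-meets zero L sp unique wf = refl
count-meets (suc n) L sp unique wf = trans count-meets-∷ (by-spec₀ (sp zero) refl)
  where
  open CountStep L sp unique wf
    (λ a → count-meets n (L ∘ suc) (instantiate a sp) (unique ∘ suc) (instantiate-LinksToEarlierFree a sp wf))
  by-spec₀ : ∀ s → sp zero ≡ s → count-at₀ s ≡ choiceCount sp L
  by-spec₀ free sp₀ = count-meets-free sp₀
  by-spec₀ (const z) sp₀ = count-meets-const z sp₀
  by-spec₀ (link w f) sp₀ with () ← proj₂ (wf zero w f sp₀)

Unique-lookup-injective : ∀ {A : Set} (xs : List A) → Unique xs → ∀ i j → List.lookup xs i ≡ List.lookup xs j → i ≡ j
Unique-lookup-injective (x ∷ xs) u zero zero e = refl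
Unique-lookup-injective (x ∷ xs) (x∉xs ∷ u) zero (suc j) e = ⊥-elim (All.lookup x∉xs (∈-lookup j) e)
Unique-lookup-injective (x ∷ xs) (x∉xs ∷ u) (suc i) zero e = ⊥-elim (All.lookup x∉xs (∈-lookup i) (sym e))
Unique-lookup-injective (x ∷ xs) (x∉xs ∷ u) (suc i) (suc j) e = cong suc (Unique-lookup-injective xs u i j e)

Unique⇒length≤ : ∀ {k} (xs : List (Fin k)) → Unique xs → length xs ≤ k
Unique⇒length≤ xs u = FinP.injective⇒≤ (λ {i} {j} → Unique-lookup-injective xs u i j)

Unique⇒distinct : ∀ {k} (xs : List (Fin k)) → Unique xs → distinct xs ≡ true
Unique⇒distinct [] u = refl
Unique⇒distinct (x ∷ xs) (x∉xs ∷ u)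
  rewrite any-false⁺ (x ==ᶠ_) xs (λ y y∈xs → ==ᶠ-≢ (All.lookup x∉xs y∈xs)) = Unique⇒distinct xs u

∉⇒All≢ : ∀ {A : Set} {x : A} xs → x ∉ xs → All (x ≢_) xs
∉⇒All≢ = ¬Any⇒All¬

∈-All≢ : ∀ {A : Set} {x : A} {xs} → All (x ≢_) xs → x ∉ xs
∈-All≢ x≢xs x∈xs = All.lookup x≢xs x∈xs refl

cross : ∀ {n} → Fin n → Fin n → Fin n → Maybe (Fin n)
cross x y a = if x ==ᶠ a then just y else (if y ==ᶠ a then just x else nothing)

cross-cases : ∀ {n} (x y a w : Fin n) → cross x y a ≡ just w → (x ≡ a × y ≡ w) ⊎ (x ≢ a × y ≡ a × x ≡ w)
cross-cases x y a w eq with x Fin.≟ a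
... | yes x≡a = inj₁ (x≡a , just-injective eq)
... | no x≢a with y Fin.≟ a
...   | yes y≡a = inj₂ (x≢a , y≡a , just-injective eq)

cross-src : ∀ {n} (x y a : Fin n) → x ≡ a → cross x y a ≡ just y
cross-src x y a x≡a rewrite ==ᶠ-complete x≡a = refl

cross-tgt : ∀ {n} (x y a : Fin n) → x ≢ a → y ≡ a → cross x y a ≡ just x
cross-tgt x y a x≢a y≡a rewrite ==ᶠ-≢ x≢a | ==ᶠ-complete y≡a = refl

cross-sym : ∀ {n} (x y a b : Fin n) → cross x y a ≡ just b → cross x y b ≡ just a
cross-sym x y a b eq with cross-cases x y a b eq
... | inj₁ (refl , refl) = cross-at-tgt
  where
  cross-at-tgt : cross x y y ≡ just x
  cross-at-tgt with x Fin.≟ y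
  ... | yes x≡y = cong just (sym x≡y)
  ... | no _ rewrite ==ᶠ-complete {x = y} refl = refl
... | inj₂ (_ , refl , refl) = cross-src x y x refl

cross-ends : ∀ {n} (x y a w : Fin n) → cross x y a ≡ just w → (a ≡ x ⊎ a ≡ y) × (w ≡ x ⊎ w ≡ y)
cross-ends x y a w eq with cross-cases x y a w eq
... | inj₁ (x≡a , y≡w) = inj₁ (sym x≡a) , inj₂ (sym y≡w)
... | inj₂ (_ , y≡a , x≡w) = inj₂ (sym y≡a) , inj₁ (sym x≡w)

cross-same-edge : ∀ {n} (x y a w s t : Fin n) → cross x y a ≡ just w → cross x y s ≡ just t →
  (s ≡ a ⊎ s ≡ w) × (t ≡ a ⊎ t ≡ w)
cross-same-edge x y a w s t e₁ e₂ with cross-cases x y a w e₁ | cross-ends x y s t e₂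
... | inj₁ (refl , refl) | s∈ , t∈ = s∈ , t∈
... | inj₂ (_ , refl , refl) | s∈ , t∈ = Sum.swap s∈ , Sum.swap t∈

-- Walks in ⟨F⟩

module Walks {n m : ℕ} (G : SignedGraph n m) (F : Vec Bool m) where
  open Spanning G F

  src tgt : Fin m → Fin n
  src e = proj₁ (ends G e)
  tgt e = proj₂ (ends G e)

  step-sym : ∀ {a b} e → step a e ≡ just b → step b e ≡ just a
  step-sym {a} {b} e = cross-sym (src e) (tgt e) a b

  step⇒adj : ∀ {w v} e → inF e ≡ true → step w e ≡ just v → adj w v ≡ true
  step⇒adj {w} {v} e e∈F s with cross-cases (src e) (tgt e) w v s
  ... | inj₁ (p , q) = any-true⁺ _ (∈-allFin e) (∧-true⁺ e∈F (∨-trueˡ _ (∧-true⁺ (==ᶠ-complete p) (==ᶠ-complete q))))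
  ... | inj₂ (_ , q , p) = any-true⁺ _ (∈-allFin e) (∧-true⁺ e∈F (∨-trueʳ _ (∧-true⁺ (==ᶠ-complete p) (==ᶠ-complete q))))

  adj⇒step : ∀ {w v} → adj w v ≡ true → ∃[ e ] (inF e ≡ true × step w e ≡ just v)
  adj⇒step {w} {v} a with any-true⁻ _ (allFin m) a
  ... | e , _ , h with ∧-true⁻ {inF e} h
  ...   | e∈F , joins = e , e∈F , joins⇒cross (src e) (tgt e) joins
    where
    joins⇒cross : ∀ x y → ((x ==ᶠ w) ∧ (y ==ᶠ v)) ∨ ((x ==ᶠ v) ∧ (y ==ᶠ w)) ≡ true → cross x y w ≡ just v
    joins⇒cross x y h with ∨-true⁻ h
    ... | inj₁ h′ = trans (cross-src x y w (==ᶠ-sound (proj₁ (∧-true⁻ h′)))) (cong just (==ᶠ-sound (proj₂ (∧-true⁻ h′))))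
    ... | inj₂ h′ = backwards (==ᶠ-sound (proj₁ (∧-true⁻ h′))) (==ᶠ-sound (proj₂ (∧-true⁻ h′))) (x Fin.≟ w)
      where
      backwards : x ≡ v → y ≡ w → Dec (x ≡ w) → cross x y w ≡ just v
      backwards x≡v y≡w (yes x≡w) = trans (cross-src x y w x≡w) (cong just (trans y≡w (trans (sym x≡w) x≡v)))
      backwards x≡v y≡w (no x≢w) = trans (cross-tgt x y w x≢w y≡w) (cong just x≡v)

  data Walk : Fin n → Fin n → Set where
    nil : ∀ {u} → Walk u u
    cons : ∀ {u w v} (e : Fin m) → inF e ≡ true → step u e ≡ just w → Walk w v → Walk u v

  edges : ∀ {u v} → Walk u v → List (Fin m)
  edges nil = []
  edges (cons e _ _ W) = e ∷ edges W

  -- The vertices after the start, so a closed walk lists its base point once, at the end.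
  verts : ∀ {u v} → Walk u v → List (Fin n)
  verts nil = []
  verts (cons {w = w} _ _ _ W) = w ∷ verts W

  len : ∀ {u v} → Walk u v → ℕ
  len nil = 0
  len (cons _ _ _ W) = suc (len W)

  len-verts : ∀ {u v} (W : Walk u v) → length (verts W) ≡ len W
  len-verts nil = refl
  len-verts (cons _ _ _ W) = cong suc (len-verts W)

  single : ∀ {u v} e → inF e ≡ true → step u e ≡ just v → Walk u v
  single e e∈F s = cons e e∈F s nil

  _++W_ : ∀ {u v w} → Walk u v → Walk v w → Walk u w
  nil ++W V = V
  cons e e∈F s W ++W V = cons e e∈F s (W ++W V)

  edges-++ : ∀ {u v w} (W : Walk u v) (V : Walk v w) → edges (W ++W V) ≡ edges W ++ edges V
  edges-++ nil V = refl
  edges-++ (cons e _ _ W) V = cong (e ∷_) (edges-++ W V)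

  len-++ : ∀ {u v w} (W : Walk u v) (V : Walk v w) → len (W ++W V) ≡ len W + len V
  len-++ nil V = refl
  len-++ (cons _ _ _ W) V = cong suc (len-++ W V)

  reverseW : ∀ {u v} → Walk u v → Walk v u
  reverseW nil = nil
  reverseW (cons e e∈F s W) = reverseW W ++W single e e∈F (step-sym e s)

  trail-edges : ∀ {u v} (W : Walk u v) → trail u (edges W) ≡ just (verts W)
  trail-edges nil = refl
  trail-edges {u} (cons {w = w} e _ s W) with step u e
  trail-edges {u} (cons {w = w} e _ refl W) | just .w rewrite trail-edges W = refl

  parity : ∀ {u v} → Walk u v → Bool
  parity W = oddNeg (edges W)

  parity-single : ∀ {u v} e e∈F (s : step u e ≡ just v) → parity (single e e∈F s) ≡ isNeg (sign G e)
  parity-single e _ _ = xor-identityʳ (isNeg (sign G e))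

  oddNeg-++ : ∀ xs ys → oddNeg (xs ++ ys) ≡ oddNeg xs xor oddNeg ys
  oddNeg-++ [] ys = refl
  oddNeg-++ (x ∷ xs) ys rewrite oddNeg-++ xs ys = sym (xor-assoc (isNeg (sign G x)) (oddNeg xs) (oddNeg ys))

  parity-++ : ∀ {u v w} (W : Walk u v) (V : Walk v w) → parity (W ++W V) ≡ parity W xor parity V
  parity-++ W V rewrite edges-++ W V = oddNeg-++ (edges W) (edges V)

  parity-reverse : ∀ {u v} (W : Walk u v) → parity (reverseW W) ≡ parity W
  parity-reverse nil = refl
  parity-reverse (cons e e∈F s W)
    rewrite parity-++ (reverseW W) (single e e∈F (step-sym e s)) | parity-reverse W | parity-single e e∈F (step-sym e s) =
    xor-comm (parity W) (isNeg (sign G e))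

  reach-suc : ∀ k {u v} → reach k u v ≡ true → reach (suc k) u v ≡ true
  reach-suc k r = ∨-trueˡ _ r

  reach-mono : ∀ {k k′} → k ≤ k′ → ∀ {u v} → reach k u v ≡ true → reach k′ u v ≡ true
  reach-mono k≤k′ = go (ℕP.≤⇒≤′ k≤k′)
    where
    go : ∀ {k k′} → k ℕ.≤′ k′ → ∀ {u v} → reach k u v ≡ true → reach k′ u v ≡ true
    go ℕ.≤′-refl r = r
    go (ℕ.≤′-step {k′} le) r = reach-suc k′ (go le r)

  reach-snoc : ∀ k {u w v} → reach k u w ≡ true → adj w v ≡ true → reach (suc k) u v ≡ true
  reach-snoc k {u} {w} {v} r a =
    ∨-trueʳ (reach k u v) (any-true⁺ (λ w′ → reach k u w′ ∧ adj w′ v) (∈-allFin w) (∧-true⁺ r a))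

  reach-refl : ∀ k u → reach k u u ≡ true
  reach-refl zero u = ==ᶠ-complete {x = u} refl
  reach-refl (suc k) u = reach-suc k (reach-refl k u)

  reach-cons : ∀ k {u w v} → adj u w ≡ true → reach k w v ≡ true → reach (suc k) u v ≡ true
  reach-cons zero {u} a r with ==ᶠ-sound r
  ... | refl = reach-snoc 0 (reach-refl 0 u) a
  reach-cons (suc k) {u} {w} {v} a r with ∨-true⁻ {reach k w v} r
  ... | inj₁ r′ = reach-suc (suc k) (reach-cons k a r′)
  ... | inj₂ r′ with any-true⁻ _ (allFin n) r′
  ...   | w′ , _ , h with ∧-true⁻ {reach k w w′} h
  ...     | r₂ , a₂ = reach-snoc (suc k) (reach-cons k a r₂) a₂

  walk⇒reach : ∀ {u v} (W : Walk u v) → reach (len W) u v ≡ true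
  walk⇒reach {u} nil = reach-refl 0 u
  walk⇒reach (cons e e∈F s W) = reach-cons (len W) (step⇒adj e e∈F s) (walk⇒reach W)

  reach⇒walk : ∀ k {u v} → reach k u v ≡ true → Walk u v
  reach⇒walk zero r with ==ᶠ-sound r
  ... | refl = nil
  reach⇒walk (suc k) {u} {v} r with ∨-true⁻ {reach k u v} r
  ... | inj₁ r′ = reach⇒walk k r′
  ... | inj₂ r′ with any-true⁻ _ (allFin n) r′
  ...   | w , _ , h with ∧-true⁻ {reach k u w} h
  ...     | r₂ , a₂ with adj⇒step a₂
  ...       | e , e∈F , s = reach⇒walk k r₂ ++W single e e∈F s

  Path : Fin n → Fin n → Set
  Path u v = Σ[ W ∈ Walk u v ] Unique (u ∷ verts W)

  suffix-from : ∀ {u w v} (W : Walk w v) → Unique (w ∷ verts W) → u ∈ (w ∷ verts W) → Path u v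
  suffix-from W u (here refl) = W , u
  suffix-from (cons e _ _ W) (_ ∷ u) (there u∈) = suffix-from W u u∈

  erase-loops : ∀ {u v} → Walk u v → Path u v
  erase-loops nil = nil , ([] ∷ [])
  erase-loops {u} (cons {w = w} e e∈F s W) with erase-loops W
  ... | W′ , unique with DecMembership._∈?_ Fin._≟_ u (w ∷ verts W′)
  ...   | yes u∈ = suffix-from W′ unique u∈
  ...   | no u∉ = cons e e∈F s W′ , ∉⇒All≢ (w ∷ verts W′) u∉ ∷ unique

  -- Loop erasure bounds the length of a connecting walk by n, the depth at which conn looks.
  walk⇒conn : ∀ {u v} → Walk u v → conn u v ≡ true
  walk⇒conn {u} W with erase-loops W
  ... | W′ , unique = reach-mono len≤n (walk⇒reach W′)
    where
    len≤n : len W′ ≤ n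
    len≤n = ℕP.≤-trans (ℕP.n≤1+n (len W′))
              (subst (_≤ n) (cong suc (len-verts W′)) (Unique⇒length≤ (u ∷ verts W′) unique))

  conn⇒walk : ∀ {u v} → conn u v ≡ true → Walk u v
  conn⇒walk = reach⇒walk n

  conn-refl : ∀ u → conn u u ≡ true
  conn-refl = reach-refl n

  conn-sym : ∀ {u v} → conn u v ≡ true → conn v u ≡ true
  conn-sym c = walk⇒conn (reverseW (conn⇒walk c))

  conn-trans : ∀ {u v w} → conn u v ≡ true → conn v w ≡ true → conn u w ≡ true
  conn-trans c d = walk⇒conn (conn⇒walk c ++W conn⇒walk d)

  adj⇒conn : ∀ {u v} → adj u v ≡ true → conn u v ≡ true
  adj⇒conn a with adj⇒step a
  ... | e , e∈F , s = walk⇒conn (single e e∈F s)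

  conn-cong : ∀ {u v} → conn u v ≡ true → ∀ w → conn u w ≡ conn v w
  conn-cong c w = true⇔true⇒≡ (conn-trans (conn-sym c)) (conn-trans c)

-- Odd closed walks contain unbalanced cycles

∈-seqs : ∀ {m} k (es : List (Fin m)) → length es ≡ k → es ∈ seqs k
∈-seqs zero [] refl = here refl
∈-seqs {m} (suc k) (e ∷ es) refl =
  ∈-concat⁺′ (∈-map⁺ (e ∷_) (∈-seqs k es refl)) (∈-map⁺ (λ e′ → map (e′ ∷_) (seqs k)) (∈-allFin e))

∈-seqsUpTo : ∀ {m} k (es : List (Fin m)) → 1 ≤ length es → length es ≤ k → es ∈ seqsUpTo k
∈-seqsUpTo zero es 1≤ ≤0 = ⊥-elim (ℕP.<-irrefl refl (ℕP.≤-trans 1≤ ≤0))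
∈-seqsUpTo (suc k) es 1≤ ≤k with length es ℕP.≟ suc k
... | yes ≡k = ∈-++⁺ˡ (∈-seqs (suc k) es ≡k)
... | no ≢k = ∈-++⁺ʳ (seqs (suc k)) (∈-seqsUpTo k es 1≤ (ℕP.≤-pred (ℕP.≤∧≢⇒< ≤k ≢k)))

module Cycles {n m : ℕ} (G : SignedGraph n m) (F : Vec Bool m) where
  open Spanning G F
  open Walks G F

  step-same-edge : ∀ {a w x y} e → step a e ≡ just w → step x e ≡ just y → (x ≡ a ⊎ x ≡ w) × (y ≡ a ⊎ y ≡ w)
  step-same-edge {a} {w} {x} {y} e = cross-same-edge (src e) (tgt e) a w x y

  edge-crossed : ∀ {a b e} (W : Walk a b) → e ∈ edges W →
    ∃[ x ] ∃[ y ] (step x e ≡ just y × x ∈ (a ∷ verts W) × y ∈ verts W)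
  edge-crossed {a} (cons {w = w} e _ s W) (here refl) = a , w , s , here refl , here refl
  edge-crossed (cons e _ _ W) (there e∈) with edge-crossed W e∈
  ... | x , y , s , x∈ , y∈ = x , y , s , there x∈ , there y∈

  end∈verts : ∀ {a b} (W : Walk a b) → 1 ≤ len W → b ∈ verts W
  end∈verts (cons e _ _ nil) _ = here refl
  end∈verts (cons e _ _ W@(cons _ _ _ _)) _ = there (end∈verts W (s≤s z≤n))

  last-verts : ∀ {a b} (W : Walk a b) → 1 ≤ len W → last? (verts W) ≡ just b
  last-verts (cons e _ _ nil) _ = refl
  last-verts (cons e _ _ W@(cons _ _ _ _)) _ = last-verts W (s≤s z≤n)

  all-inF-edges : ∀ {a b} (W : Walk a b) → all inF (edges W) ≡ true
  all-inF-edges nil = refl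
  all-inF-edges (cons e e∈F _ W) = ∧-true⁺ e∈F (all-inF-edges W)

  path-edges-unique : ∀ {a b} (W : Walk a b) → Unique (a ∷ verts W) → Unique (edges W)
  path-edges-unique nil _ = []
  path-edges-unique {a} (cons {w = w} e _ s W) (a∉ ∷ w∉ ∷ unique) =
    ∉⇒All≢ (edges W) e∉ ∷ path-edges-unique W (w∉ ∷ unique)
    where
    e∉ : e ∉ edges W
    e∉ e∈ with edge-crossed W e∈
    ... | x , y , s′ , _ , y∈ with proj₂ (step-same-edge e s s′)
    ...   | inj₁ refl = ∈-All≢ a∉ (there y∈)
    ...   | inj₂ refl = ∈-All≢ w∉ y∈

  -- The only way a cycle through distinct vertices can repeat an edge is to go back and forth
  -- along it, and such a closed walk is even.
  odd-cycle-edges-unique : ∀ {u} (W : Walk u u) → Unique (verts W) → parity W ≡ true → Unique (edges W)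
  odd-cycle-edges-unique (cons e _ _ nil) _ _ = [] ∷ []
  odd-cycle-edges-unique (cons e₁ _ _ (cons e₂ _ _ nil)) _ odd with e₁ Fin.≟ e₂
  ... | yes refl = ⊥-elim (false≢true (trans (sym (back-and-forth (isNeg (sign G e₁)))) odd))
    where
    back-and-forth : ∀ b → b xor (b xor false) ≡ false
    back-and-forth b = trans (cong (b xor_) (xor-identityʳ b)) (xor-same b)
  ... | no e₁≢e₂ = (e₁≢e₂ ∷ []) ∷ ([] ∷ [])
  odd-cycle-edges-unique {u} (cons {w = v₁} e₁ _ s₁ W₁@(cons {w = v₂} e₂ _ s₂ W₂@(cons _ _ _ _))) (v₁∉ ∷ v₂∉ ∷ unique) _ =
    (e₁≢e₂ ∷ ∉⇒All≢ (edges W₂) e₁∉) ∷ path-edges-unique W₁ (v₁∉ ∷ v₂∉ ∷ unique)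
    where
    e₁≢e₂ : e₁ ≢ e₂
    e₁≢e₂ refl with proj₂ (step-same-edge e₁ s₁ s₂)
    ... | inj₁ refl = ∈-All≢ v₂∉ (end∈verts W₂ (s≤s z≤n))
    ... | inj₂ refl = ∈-All≢ v₁∉ (here refl)
    e₁∉ : e₁ ∉ edges W₂
    e₁∉ e∈ with edge-crossed W₂ e∈
    ... | x , y , s′ , x∈ , y∈ with step-same-edge e₁ s₁ s′
    ...   | _ , inj₂ refl = ∈-All≢ v₁∉ (there y∈)
    ...   | inj₂ refl , _ = ∈-All≢ v₁∉ x∈
    ...   | inj₁ refl , inj₁ refl = ∈-All≢ v₁∉ (there (subst (_∈ verts W₂) (just-injective (trans (sym s′) s₁)) y∈))

  isCycle-∷ : ∀ v₀ e es vs → trail v₀ (e ∷ es) ≡ just vs →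
    isCycle v₀ (e ∷ es) ≡ (all inF (e ∷ es) ∧ distinct (e ∷ es) ∧ distinct vs ∧ Maybe.maybe (_==ᶠ v₀) false (last? vs))
  isCycle-∷ v₀ e es vs eq with trail v₀ (e ∷ es)
  isCycle-∷ v₀ e es vs refl | just .vs = refl

  OddCycleAt : Fin n → Set
  OddCycleAt v₀ = ∃[ es ] (es ∈ seqsUpTo m × (isCycle v₀ es ∧ oddNeg es) ≡ true)

  odd-simple-closed-walk⇒OddCycleAt : ∀ {u} (W : Walk u u) → Unique (verts W) → parity W ≡ true → OddCycleAt u
  odd-simple-closed-walk⇒OddCycleAt {u} W@(cons e _ _ W₁) unique odd = edges W , es∈ , ∧-true⁺ is-cycle odd
    where
    edges-unique : Unique (edges W)
    edges-unique = odd-cycle-edges-unique W unique odd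
    es∈ : edges W ∈ seqsUpTo m
    es∈ = ∈-seqsUpTo m (edges W) (s≤s z≤n) (Unique⇒length≤ (edges W) edges-unique)
    is-cycle : isCycle u (edges W) ≡ true
    is-cycle rewrite isCycle-∷ u e (edges W₁) (verts W) (trail-edges W) | last-verts W (s≤s z≤n) =
      ∧-true⁺ (all-inF-edges W) (∧-true⁺ (Unique⇒distinct (edges W) edges-unique)
        (∧-true⁺ (Unique⇒distinct (verts W) unique) (==ᶠ-complete {x = u} refl)))

  record SplitAt {a b} (x : Fin n) (W : Walk a b) : Set where
    field
      before : Walk a x
      after : Walk x b
      before-nonempty : 1 ≤ len before
      len-split : len before + len after ≡ len W
      parity-split : parity before xor parity after ≡ parity W

  splitAt : ∀ {a b x} (W : Walk a b) → x ∈ verts W → SplitAt x W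
  splitAt (cons e e∈F s W) (here refl) = record
    { before = single e e∈F s ; after = W ; before-nonempty = s≤s z≤n ; len-split = refl
    ; parity-split = cong (_xor parity W) (parity-single e e∈F s) }
  splitAt (cons e e∈F s W) (there x∈) = record
    { before = cons e e∈F s before ; after = after ; before-nonempty = s≤s z≤n ; len-split = cong suc len-split
    ; parity-split = trans (xor-assoc (isNeg (sign G e)) (parity before) (parity after))
                           (cong (isNeg (sign G e) xor_) parity-split) }
    where open SplitAt (splitAt W x∈)

  record Detour {a b} (W : Walk a b) : Set where
    field
      x : Fin n
      A : Walk a x
      C : Walk x x
      B : Walk x b
      len-C< : len C < len W
      len-AB< : len A + len B < len W
      parity-detour : parity C xor (parity A xor parity B) ≡ parity W

  unique-or-detour : ∀ {a b} (W : Walk a b) → Unique (verts W) ⊎ Detour W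
  unique-or-detour nil = inj₁ []
  unique-or-detour (cons {w = w} e e∈F s W) with unique-or-detour W
  ... | inj₂ d = inj₂ record
      { x = x ; A = cons e e∈F s A ; C = C ; B = B
      ; len-C< = ℕP.<-trans len-C< (ℕP.n<1+n _) ; len-AB< = s≤s len-AB<
      ; parity-detour = trans (cong (parity C xor_) (xor-assoc (isNeg (sign G e)) (parity A) (parity B)))
                          (trans (xor-lcomm (parity C) (isNeg (sign G e)) _) (cong (isNeg (sign G e) xor_) parity-detour)) }
    where open Detour d
  ... | inj₁ unique with DecMembership._∈?_ Fin._≟_ w (verts W)
  ...   | no w∉ = inj₁ (∉⇒All≢ (verts W) w∉ ∷ unique)
  ...   | yes w∈ = inj₂ record
      { x = w ; A = single e e∈F s ; C = before ; B = after
      ; len-C< = s≤s (ℕP.m+n≤o⇒m≤o (len before) (ℕP.≤-reflexive len-split))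
      ; len-AB< = s≤s (subst (len after <_) len-split (ℕP.m<n+m (len after) before-nonempty))
      ; parity-detour = trans (cong (λ t → parity before xor (t xor parity after)) (parity-single e e∈F s))
                          (trans (xor-lcomm (parity before) (isNeg (sign G e)) (parity after))
                                 (cong (isNeg (sign G e) xor_) parity-split)) }
    where open SplitAt (splitAt W w∈)

  -- Either the detour C or the remainder A ++ B is odd; recurse into whichever is.
  odd-closed-walk⇒OddCycle : ∀ k {u} (W : Walk u u) → len W ≤ k → parity W ≡ true →
    ∃[ v₀ ] (Walk u v₀ × OddCycleAt v₀)
  odd-closed-walk⇒OddCycle (suc k) {u} W len≤ odd with unique-or-detour W
  ... | inj₁ unique = u , nil , odd-simple-closed-walk⇒OddCycleAt W unique odd
  ... | inj₂ d = by-parity-of-C (parity C) refl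
    where
    open Detour d
    by-parity-of-C : ∀ b → parity C ≡ b → ∃[ v₀ ] (Walk u v₀ × OddCycleAt v₀)
    by-parity-of-C true C-odd with odd-closed-walk⇒OddCycle k C (ℕP.≤-pred (ℕP.≤-trans len-C< len≤)) C-odd
    ... | v₀ , W₀ , cycle = v₀ , A ++W W₀ , cycle
    by-parity-of-C false C-even =
      odd-closed-walk⇒OddCycle k (A ++W B)
        (ℕP.≤-pred (ℕP.≤-trans (subst (_< len W) (sym (len-++ A B)) len-AB<) len≤))
        (trans (parity-++ A B) (trans (cong (_xor (parity A xor parity B)) (sym C-even)) (trans parity-detour odd)))
  odd-closed-walk⇒OddCycle zero nil _ ()

  odd-closed-walk⇒unbalanced : ∀ {u x} → Walk u x → (W : Walk x x) → parity W ≡ true → unbalancedAt u ≡ true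
  odd-closed-walk⇒unbalanced A W odd with odd-closed-walk⇒OddCycle (len W) W ℕP.≤-refl odd
  ... | v₀ , W₀ , es , es∈ , cycle =
    any-true⁺ _ (∈-allFin v₀) (∧-true⁺ (walk⇒conn (A ++W W₀)) (any-true⁺ _ es∈ cycle))

  trail⇒walk : ∀ a es vs → trail a es ≡ just vs → all inF es ≡ true →
    ∃[ b ] Σ[ W ∈ Walk a b ] (verts W ≡ vs × edges W ≡ es)
  trail⇒walk a [] .[] refl _ = a , nil , refl , refl
  trail⇒walk a (e ∷ es) vs tr inF-es with step a e in s
  ... | just w with trail w es in tr′
  trail⇒walk a (e ∷ es) .(w ∷ vs′) refl inF-es | just w | just vs′
    with trail⇒walk w es vs′ tr′ (proj₂ (∧-true⁻ {inF e} inF-es))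
  ... | b , W , refl , refl = b , cons e (proj₁ (∧-true⁻ {inF e} inF-es)) s W , refl , refl

  cycle⇒closed-walk : ∀ v₀ es → isCycle v₀ es ≡ true → Σ[ W ∈ Walk v₀ v₀ ] edges W ≡ es
  cycle⇒closed-walk v₀ (e ∷ es) cyc with trail v₀ (e ∷ es) in tr
  ... | just vs with ∧-true⁻ {all inF (e ∷ es)} cyc
  ...   | inF-es , rest with trail⇒walk v₀ (e ∷ es) vs tr inF-es
  ...     | b , W@(cons _ _ _ _) , refl , refl
    with refl ← ==ᶠ-sound (subst (λ l → Maybe.maybe (_==ᶠ v₀) false l ≡ true) (last-verts W (s≤s z≤n))
                            (proj₂ (∧-true⁻ {distinct vs} (proj₂ (∧-true⁻ {distinct (e ∷ es)} rest)))))
    = W , refl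

  unbalanced⇒odd-closed-walk : ∀ {v} → unbalancedAt v ≡ true →
    ∃[ v₀ ] (Walk v v₀ × Σ[ W ∈ Walk v₀ v₀ ] parity W ≡ true)
  unbalanced⇒odd-closed-walk {v} ub with any-true⁻ _ (allFin n) ub
  ... | v₀ , _ , h with ∧-true⁻ {conn v v₀} h
  ...   | c , h′ with any-true⁻ _ (seqsUpTo m) h′
  ...     | es , _ , h″ with ∧-true⁻ {isCycle v₀ es} h″
  ...       | cyc , odd with cycle⇒closed-walk v₀ es cyc
  ...         | W , refl = v₀ , conn⇒walk c , W , odd

negateIf : Bool → ℤ → ℤ
negateIf true a = - a
negateIf false a = a

negateIf-xor : ∀ a b t → negateIf a (negateIf b t) ≡ negateIf (a xor b) t
negateIf-xor true true t = ℤP.neg-involutive t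
negateIf-xor true false t = refl
negateIf-xor false b t = refl

negateIf-involutive : ∀ b t → negateIf b (negateIf b t) ≡ t
negateIf-involutive b t = trans (negateIf-xor b b t) (cong (λ x → negateIf x t) (xor-same b))

negateIf-0 : ∀ b → negateIf b (+ 0) ≡ + 0
negateIf-0 true = refl
negateIf-0 false = refl

act≡negateIf : ∀ s t → act s t ≡ negateIf (isNeg s) t
act≡negateIf pos t = refl
act≡negateIf neg t = refl

x≡-x⇒x≡0 : ∀ (x : ℤ) → x ≡ - x → x ≡ + 0
x≡-x⇒x≡0 (+ zero) _ = refl
x≡-x⇒x≡0 (+ suc _) ()
x≡-x⇒x≡0 ℤ.-[1+ _ ] ()

∈ℤ-map-neg : ∀ (a : ℤ) xs → (a ∈ℤ map -_ xs) ≡ ((- a) ∈ℤ xs)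
∈ℤ-map-neg a [] = refl
∈ℤ-map-neg a (x ∷ xs) = cong₂ _∨_
  (true⇔true⇒≡ (λ h → ==ℤ-complete (trans (cong -_ (==ℤ-sound h)) (ℤP.neg-involutive x)))
               (λ h → ==ℤ-complete (trans (sym (ℤP.neg-involutive a)) (cong -_ (==ℤ-sound h)))))
  (∈ℤ-map-neg a xs)

∈ℤ-negateIf : ∀ b c a xs → (negateIf c a ∈ℤ (if b then map -_ xs else xs)) ≡ (negateIf (b xor c) a ∈ℤ xs)
∈ℤ-negateIf false c a xs = refl
∈ℤ-negateIf true false a xs = ∈ℤ-map-neg a xs
∈ℤ-negateIf true true a xs = trans (∈ℤ-map-neg (- a) xs) (cong (_∈ℤ xs) (ℤP.neg-involutive a))

least : ∀ {k} → (Fin k → Bool) → Maybe (Fin k)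
least {zero} p = nothing
least {suc k} p = if p zero then just zero else Maybe.map suc (least (p ∘ suc))

least-spec : ∀ {k} (p : Fin k → Bool) v → p v ≡ true →
  ∃[ w ] (least p ≡ just w × p w ≡ true × (∀ w′ → p w′ ≡ true → Fin.toℕ w ≤ Fin.toℕ w′))
least-spec {suc k} p v pv with p zero in p₀
... | true = zero , refl , p₀ , λ _ _ → z≤n
... | false with v
...   | zero = ⊥-elim (false≢true (trans (sym p₀) pv))
...   | suc v′ with least-spec (p ∘ suc) v′ pv
...     | w , eq , pw , minimal rewrite eq = suc w , refl , pw , minimal′
  where
  minimal′ : ∀ w′ → p w′ ≡ true → Fin.toℕ (suc w) ≤ Fin.toℕ w′
  minimal′ zero pz = ⊥-elim (false≢true (trans (sym p₀) pz))
  minimal′ (suc w′) pw′ = s≤s (minimal w′ pw′)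

-- Components of ⟨F⟩ and their switchings

module Components {n m : ℕ} (G : SignedGraph n m) (F : Vec Bool m) where
  open Spanning G F
  open Walks G F
  open Cycles G F

  rep : Fin n → Fin n
  rep v = Maybe.fromMaybe v (least (λ w → conn w v))

  rep-spec : ∀ v → conn (rep v) v ≡ true × (∀ w → conn w v ≡ true → Fin.toℕ (rep v) ≤ Fin.toℕ w)
  rep-spec v with least-spec (λ w → conn w v) v (conn-refl v)
  ... | w , eq , cw , minimal rewrite eq = cw , minimal

  conn-rep : ∀ v → conn (rep v) v ≡ true
  conn-rep v = proj₁ (rep-spec v)

  rep≤ : ∀ v → Fin.toℕ (rep v) ≤ Fin.toℕ v
  rep≤ v = proj₂ (rep-spec v) v (conn-refl v)

  rep-cong : ∀ {u v} → conn u v ≡ true → rep u ≡ rep v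
  rep-cong {u} {v} c = FinP.toℕ-injective (ℕP.≤-antisym
    (proj₂ (rep-spec u) (rep v) (conn-trans (conn-rep v) (conn-sym c)))
    (proj₂ (rep-spec v) (rep u) (conn-trans (conn-rep u) c)))

  rep-idem : ∀ v → rep (rep v) ≡ rep v
  rep-idem v = rep-cong (conn-rep v)

  rep≢⇒rep< : ∀ v → rep v ==ᶠ v ≡ false → Fin.toℕ (rep v) < Fin.toℕ v
  rep≢⇒rep< v rv = ℕP.≤∧≢⇒< (rep≤ v) (λ e → false≢true (trans (sym rv) (==ᶠ-complete (FinP.toℕ-injective e))))

  isRep-rep : ∀ r → rep r ≡ r → isRep r ≡ true
  isRep-rep r rr = all-true⁺ _ (allFin n) not-earlier
    where
    not-earlier : ∀ w → w ∈ allFin n → not ((Fin.toℕ w ℕ.<ᵇ Fin.toℕ r) ∧ conn w r) ≡ true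
    not-earlier w _ with Fin.toℕ w ℕ.<ᵇ Fin.toℕ r in lt | conn w r in cw
    ... | false | _ = refl
    ... | true | false = refl
    ... | true | true = ⊥-elim (ℕP.<-irrefl refl (ℕP.<-≤-trans (ℕP.<ᵇ⇒< _ _ (≡true⇒T lt))
                          (subst (λ t → Fin.toℕ t ≤ Fin.toℕ w) rr (proj₂ (rep-spec r) w cw))))

  isRep-¬rep : ∀ r → rep r ==ᶠ r ≡ false → isRep r ≡ false
  isRep-¬rep r rr = all-false⁺ _ (∈-allFin (rep r)) earlier
    where
    earlier : not ((Fin.toℕ (rep r) ℕ.<ᵇ Fin.toℕ r) ∧ conn (rep r) r) ≡ false
    earlier rewrite T⇒≡true (ℕP.<⇒<ᵇ (rep≢⇒rep< r rr)) | conn-rep r = refl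

  unbalancedAt-cong : ∀ {u v} → conn u v ≡ true → unbalancedAt u ≡ unbalancedAt v
  unbalancedAt-cong c = any-cong (λ v₀ → cong (_∧ _) (conn-cong c v₀)) (allFin n)

  switchingSet : Fin n → Maybe (Vec Bool n)
  switchingSet r = first (validPart r) (allSubsets n)

  validPart-edge : ∀ {r} X {e} → validPart r X ≡ true → inF e ≡ true → conn r (src e) ≡ true → conn r (tgt e) ≡ true →
    Vec.lookup X (src e) xor Vec.lookup X (tgt e) ≡ isNeg (sign G e)
  validPart-edge {r} X {e} valid e∈F cx cy =
    not-xor-true⇒≡ _ _ (within {inF e} (all-true⁻ _ valid (∈-allFin e)) e∈F cx cy)
    where
    within : ∀ {a b c d} → not (a ∧ b ∧ c) ∨ d ≡ true → a ≡ true → b ≡ true → c ≡ true → d ≡ true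
    within h refl refl refl = h

  walk-parity-sides : ∀ {r} X → validPart r X ≡ true → ∀ {a w} → conn r a ≡ true → (W : Walk a w) →
    parity W ≡ Vec.lookup X a xor Vec.lookup X w
  walk-parity-sides X valid {a} ca nil = sym (xor-same (Vec.lookup X a))
  walk-parity-sides {r} X valid {a} {w} ca (cons {w = a′} e e∈F s W) = begin
      isNeg (sign G e) xor parity W
        ≡⟨ cong₂ _xor_ (sym edge-sides) (walk-parity-sides X valid ca′ W) ⟩
      (Vec.lookup X a xor Vec.lookup X a′) xor (Vec.lookup X a′ xor Vec.lookup X w)
        ≡⟨ xor-telescope (Vec.lookup X a) (Vec.lookup X a′) (Vec.lookup X w) ⟩
      Vec.lookup X a xor Vec.lookup X w ∎
    where
    open ≡-Reasoning
    ca′ : conn r a′ ≡ true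
    ca′ = conn-trans ca (walk⇒conn (single e e∈F s))
    edge-sides : Vec.lookup X a xor Vec.lookup X a′ ≡ isNeg (sign G e)
    edge-sides with cross-cases (src e) (tgt e) a a′ s
    ... | inj₁ (refl , refl) = validPart-edge X {e} valid e∈F ca ca′
    ... | inj₂ (_ , refl , refl) = trans (xor-comm (Vec.lookup X a) (Vec.lookup X a′)) (validPart-edge X {e} valid e∈F ca′ ca)

  side-of : ∀ r v b → conn r v ≡ b → Bool
  side-of r v true c = parity (conn⇒walk c)
  side-of r v false _ = false

  side : Fin n → Fin n → Bool
  side r v = side-of r v (conn r v) refl

  side-spec : ∀ r v → conn r v ≡ true → Σ[ W ∈ Walk r v ] side r v ≡ parity W
  side-spec r v = spec (conn r v) refl
    where
    spec : ∀ b (c : conn r v ≡ b) → b ≡ true → Σ[ W ∈ Walk r v ] side-of r v b c ≡ parity W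
    spec true c _ = conn⇒walk c , refl

  -- In a balanced component the parity of any walk from r is a valid switching set.
  sides-valid : ∀ r → unbalancedAt r ≡ false → validPart r (Vec.tabulate (side r)) ≡ true
  sides-valid r balanced = all-true⁺ _ (allFin m) edge-ok
    where
    X = Vec.tabulate (side r)
    edge-ok : ∀ e → e ∈ allFin m → (not (inF e ∧ conn r (src e) ∧ conn r (tgt e)) ∨
          not ((Vec.lookup X (src e) xor Vec.lookup X (tgt e)) xor isNeg (sign G e))) ≡ true
    edge-ok e _ with inF e ∧ conn r (src e) ∧ conn r (tgt e) in h
    ... | false = refl
    ... | true with ∧-true⁻ {inF e} h
    ...   | e∈F , h′ with ∧-true⁻ {conn r (src e)} h′
    ...     | cx , cy with side-spec r (src e) cx | side-spec r (tgt e) cy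
    ...       | Wx , sx | Wy , sy
      rewrite VecP.lookup∘tabulate (side r) (src e) | VecP.lookup∘tabulate (side r) (tgt e) | sx | sy
      with (parity Wx xor parity Wy) xor isNeg (sign G e) in odd
    ...         | false = refl
    ...         | true = ⊥-elim (false≢true (trans (sym balanced) (odd-closed-walk⇒unbalanced nil closed closed-odd)))
      where
      crossing = single e e∈F (cross-src (src e) (tgt e) (src e) refl)
      closed : Walk r r
      closed = Wx ++W (crossing ++W reverseW Wy)
      closed-odd : parity closed ≡ true
      closed-odd rewrite parity-++ Wx (crossing ++W reverseW Wy) | parity-++ crossing (reverseW Wy)
                       | parity-single e e∈F (cross-src (src e) (tgt e) (src e) refl) | parity-reverse Wy =
        trans (xor-lcomm (parity Wx) (isNeg (sign G e)) (parity Wy))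
              (trans (xor-comm (isNeg (sign G e)) _) odd)

  switchingSet-exists : ∀ r → unbalancedAt r ≡ false → Σ[ X ∈ Vec Bool n ] (switchingSet r ≡ just X × validPart r X ≡ true)
  switchingSet-exists r balanced =
    first-complete (validPart r) (allSubsets n) (∈-allSubsets n (Vec.tabulate (side r))) (sides-valid r balanced)

  transfer : Fin n → Fin n → ℤ → ℤ
  transfer r v a = Maybe.maybe′ (λ X → negateIf (Vec.lookup X v xor Vec.lookup X r) a) a (switchingSet r)

  transfer-switchingSet : ∀ {r X} → switchingSet r ≡ just X → ∀ v a → transfer r v a ≡ negateIf (Vec.lookup X v xor Vec.lookup X r) a
  transfer-switchingSet eq v a rewrite eq = refl

  -- Unbalanced components are pinned to 0; a balanced one is determined by the value at its
  -- least vertex, transferred to the others through the switching set.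
  specAt : Fin n → Bool → Bool → Spec n
  specAt v true _ = const (+ 0)
  specAt v false true = free
  specAt v false false = link (rep v) (transfer (rep v) v)

  componentSpec : Fin n → Spec n
  componentSpec v = specAt v (unbalancedAt v) (rep v ==ᶠ v)

  componentSpec-LinksToEarlierFree : LinksToEarlierFree componentSpec
  componentSpec-LinksToEarlierFree v w f e with unbalancedAt v in ub | rep v ==ᶠ v in rv
  componentSpec-LinksToEarlierFree v .(rep v) f refl | false | false = rep-free , rep≢⇒rep< v rv
    where
    rep-free : componentSpec (rep v) ≡ free
    rep-free rewrite unbalancedAt-cong (conn-rep v) | ub | rep-idem v | ==ᶠ-complete {x = rep v} refl = refl

  open Violations G using (violates; violatesAll)

  module _ (c : Fin n → ℤ) (viol : violatesAll F c ≡ true) where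

    violating-step : ∀ {a b} e → inF e ≡ true → step a e ≡ just b → c b ≡ negateIf (isNeg (sign G e)) (c a)
    violating-step {a} {b} e e∈F s
      with ==ℤ-sound (implication-true (all-true⁻ (λ e → not (inF e) ∨ violates c e) viol (∈-allFin e)) e∈F)
         | cross-cases (src e) (tgt e) a b s
    ... | ca≡σcb | inj₁ (refl , refl) = sym (begin
        negateIf (isNeg (sign G e)) (c a)      ≡⟨ cong (negateIf (isNeg (sign G e))) (trans ca≡σcb (act≡negateIf (sign G e) (c b))) ⟩
        negateIf (isNeg (sign G e)) (negateIf (isNeg (sign G e)) (c b)) ≡⟨ negateIf-involutive (isNeg (sign G e)) (c b) ⟩
        c b ∎)
      where open ≡-Reasoning
    ... | cb≡σca | inj₂ (_ , refl , refl) = trans cb≡σca (act≡negateIf (sign G e) (c a))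

    violating-walk : ∀ {a b} (W : Walk a b) → c b ≡ negateIf (parity W) (c a)
    violating-walk nil = refl
    violating-walk {a} (cons e e∈F s W) = begin
        _                                                                  ≡⟨ violating-walk W ⟩
        negateIf (parity W) (c _)                                          ≡⟨ cong (negateIf (parity W)) (violating-step e e∈F s) ⟩
        negateIf (parity W) (negateIf (isNeg (sign G e)) (c a))            ≡⟨ negateIf-xor (parity W) (isNeg (sign G e)) (c a) ⟩
        negateIf (parity W xor isNeg (sign G e)) (c a)                     ≡⟨ cong (λ b → negateIf b (c a)) (xor-comm (parity W) _) ⟩
        negateIf (isNeg (sign G e) xor parity W) (c a) ∎
      where open ≡-Reasoning

    -- An odd closed walk at v₀ forces c v₀ = - c v₀.
    violating-unbalanced : ∀ v → unbalancedAt v ≡ true → c v ≡ + 0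
    violating-unbalanced v ub with unbalanced⇒odd-closed-walk ub
    ... | v₀ , A , W , odd = begin
        c v                                              ≡⟨ negateIf-involutive (parity A) (c v) ⟨
        negateIf (parity A) (negateIf (parity A) (c v))  ≡⟨ cong (negateIf (parity A)) (violating-walk A) ⟨
        negateIf (parity A) (c v₀)                       ≡⟨ cong (negateIf (parity A)) c₀≡0 ⟩
        negateIf (parity A) (+ 0)                        ≡⟨ negateIf-0 (parity A) ⟩
        + 0 ∎
      where
      open ≡-Reasoning
      c₀≡0 : c v₀ ≡ + 0
      c₀≡0 = x≡-x⇒x≡0 (c v₀) (trans (violating-walk W) (cong (λ b → negateIf b (c v₀)) odd))

    violating-balanced : ∀ {r} X → validPart r X ≡ true → ∀ {v} → conn r v ≡ true →
      c v ≡ negateIf (Vec.lookup X v xor Vec.lookup X r) (c r)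
    violating-balanced {r} X valid {v} crv = trans (violating-walk W)
      (cong (λ b → negateIf b (c r)) (trans (walk-parity-sides X valid (conn-refl r) W) (xor-comm (Vec.lookup X r) _)))
      where
      W = conn⇒walk crv

  violatesAll⇒meets : ∀ c → violatesAll F c ≡ true → meets componentSpec c ≡ true
  violatesAll⇒meets c viol = all-true⁺ _ (allFin n) satisfied
    where
    satisfied : ∀ v → v ∈ allFin n → satisfies c v (componentSpec v) ≡ true
    satisfied v _ with unbalancedAt v in ub | rep v ==ᶠ v
    ... | true | _ = ==ℤ-complete (violating-unbalanced c viol v ub)
    ... | false | true = refl
    ... | false | false with switchingSet-exists (rep v) (trans (unbalancedAt-cong (conn-rep v)) ub)
    ...   | X , eq , valid = ==ℤ-complete
            (trans (violating-balanced c viol X valid (conn-rep v)) (sym (transfer-switchingSet eq v (c (rep v)))))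

  module _ (c : Fin n → ℤ) (met : meets componentSpec c ≡ true) where

    meets-at : ∀ v → satisfies c v (componentSpec v) ≡ true
    meets-at v = all-true⁻ (λ v → satisfies c v (componentSpec v)) met (∈-allFin v)

    meets-unbalanced : ∀ v → unbalancedAt v ≡ true → c v ≡ + 0
    meets-unbalanced v ub with meets-at v
    ... | ok rewrite ub = ==ℤ-sound ok

    meets-balanced : ∀ v X → switchingSet (rep v) ≡ just X → unbalancedAt v ≡ false →
      c v ≡ negateIf (Vec.lookup X v xor Vec.lookup X (rep v)) (c (rep v))
    meets-balanced v X eq ub with meets-at v
    ... | ok rewrite ub with rep v ==ᶠ v in rv
    ...   | true rewrite ==ᶠ-sound rv | xor-same (Vec.lookup X v) = refl
    ...   | false = trans (==ℤ-sound ok) (transfer-switchingSet eq v (c (rep v)))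

    meets-edge : ∀ e → inF e ≡ true → c (src e) ≡ act (sign G e) (c (tgt e))
    meets-edge e e∈F = by-component (unbalancedAt x) refl
      where
      x = src e
      y = tgt e
      ne = isNeg (sign G e)
      cxy : conn x y ≡ true
      cxy = adj⇒conn (step⇒adj e e∈F (cross-src x y x refl))
      ry : rep y ≡ rep x
      ry = sym (rep-cong cxy)
      by-component : ∀ b → unbalancedAt x ≡ b → c x ≡ act (sign G e) (c y)
      by-component true ub = begin
          c x                 ≡⟨ meets-unbalanced x ub ⟩
          + 0                 ≡⟨ negateIf-0 ne ⟨
          negateIf ne (+ 0)   ≡⟨ cong (negateIf ne) (meets-unbalanced y (trans (sym (unbalancedAt-cong cxy)) ub)) ⟨
          negateIf ne (c y)   ≡⟨ act≡negateIf (sign G e) (c y) ⟨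
          act (sign G e) (c y) ∎
        where open ≡-Reasoning
      by-component false ub with switchingSet-exists (rep x) (trans (unbalancedAt-cong (conn-rep x)) ub)
      ... | X , eq , valid = sym (begin
          act (sign G e) (c y)                         ≡⟨ act≡negateIf (sign G e) (c y) ⟩
          negateIf ne (c y)                            ≡⟨ cong (negateIf ne) cy ⟩
          negateIf ne (negateIf (ξ y xor ξ r) (c r))   ≡⟨ negateIf-xor ne (ξ y xor ξ r) (c r) ⟩
          negateIf (ne xor (ξ y xor ξ r)) (c r)        ≡⟨ cong (λ b → negateIf (b xor (ξ y xor ξ r)) (c r)) edge-sides ⟨
          negateIf ((ξ x xor ξ y) xor (ξ y xor ξ r)) (c r) ≡⟨ cong (λ b → negateIf b (c r)) (xor-telescope (ξ x) (ξ y) (ξ r)) ⟩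
          negateIf (ξ x xor ξ r) (c r)                 ≡⟨ meets-balanced x X eq ub ⟨
          c x ∎)
        where
        open ≡-Reasoning
        ξ = Vec.lookup X
        r = rep x
        cy : c y ≡ negateIf (ξ y xor ξ r) (c r)
        cy = subst (λ t → c y ≡ negateIf (ξ y xor ξ t) (c t)) ry
               (meets-balanced y X (subst (λ t → switchingSet t ≡ just X) (sym ry) eq) (trans (sym (unbalancedAt-cong cxy)) ub))
        edge-sides : ξ x xor ξ y ≡ ne
        edge-sides = validPart-edge X {e} valid e∈F (conn-rep x) (subst (λ t → conn t y ≡ true) ry (conn-rep y))

  meets⇒violatesAll : ∀ c → meets componentSpec c ≡ true → violatesAll F c ≡ true
  meets⇒violatesAll c met = all-true⁺ _ (allFin m) violated
    where
    violated : ∀ e → e ∈ allFin m → (not (inF e) ∨ violates c e) ≡ true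
    violated e _ with inF e in e∈F
    ... | false = refl
    ... | true = ==ℤ-complete (meets-edge c met e e∈F)

  violatesAll≡meets : ∀ c → violatesAll F c ≡ meets componentSpec c
  violatesAll≡meets c = true⇔true⇒≡ (violatesAll⇒meets c) (meets⇒violatesAll c)

-- Counting the colorings that violate every edge of F

∈⇒∈ℤ : ∀ {a : ℤ} {xs} → a ∈ xs → a ∈ℤ xs ≡ true
∈⇒∈ℤ {a} a∈ = any-true⁺ (a ==ℤ_) a∈ (==ℤ-complete refl)

if-𝟙 : ∀ b → (if b then + 1 else + 0) ≡ + 𝟙 b
if-𝟙 true = refl
if-𝟙 false = refl

prodℤ-map-+ : ∀ {A : Set} (f : A → ℕ) xs → prodℤ (map (λ x → + f x) xs) ≡ + product (map f xs)
prodℤ-map-+ f [] = refl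
prodℤ-map-+ f (x ∷ xs) = trans (cong (+ f x *ℤ_) (prodℤ-map-+ f xs)) (sym (ℤP.pos-* (f x) (product (map f xs))))

module Counting {n m : ℕ} (G : SignedGraph n m) (F : Vec Bool m) (L : Fin n → List ℤ) where
  open Spanning G F
  open Components G F
  open Violations G using (violatesAll)

  switchedList : Vec Bool n → Fin n → List ℤ
  switchedList X v = if Vec.lookup X v then map -_ (L v) else L v

  β-switchingSet : ∀ r X → switchingSet r ≡ just X →
    β r L ≡ count (λ a → all (λ v → not (conn r v) ∨ (a ∈ℤ switchedList X v)) (allFin n)) (switchedList X r)
  β-switchingSet r X eq with first (validPart r) (allSubsets n)
  β-switchingSet r X refl | just .X = refl

  linkFits-componentSpec : ∀ r X → unbalancedAt r ≡ false → rep r ≡ r → switchingSet r ≡ just X →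
    ∀ a → a ∈ L r → ∀ u →
    (not (conn r u) ∨ (negateIf (Vec.lookup X r) a ∈ℤ switchedList X u)) ≡ linkFits L r a u (componentSpec u)
  linkFits-componentSpec r X balanced rr eq a a∈ u
    rewrite ∈ℤ-negateIf (Vec.lookup X u) (Vec.lookup X r) a (L u)
    with unbalancedAt u in ub | rep u ==ᶠ u in ru | conn r u in cru
  ... | true | _ | false = refl
  ... | true | _ | true = ⊥-elim (false≢true (trans (sym balanced) (trans (unbalancedAt-cong cru) ub)))
  ... | false | true | false = refl
  ... | false | true | true
    rewrite trans (sym (==ᶠ-sound ru)) (trans (sym (rep-cong cru)) rr) | xor-same (Vec.lookup X r) = ∈⇒∈ℤ a∈
  ... | false | false | true = sym (begin
      not (rep u ==ᶠ r) ∨ (transfer (rep u) u a ∈ℤ L u)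
        ≡⟨ cong (λ t → not (t ==ᶠ r) ∨ (transfer t u a ∈ℤ L u)) ur ⟩
      not (r ==ᶠ r) ∨ (transfer r u a ∈ℤ L u)
        ≡⟨ cong (λ b → not b ∨ (transfer r u a ∈ℤ L u)) (==ᶠ-complete {x = r} refl) ⟩
      transfer r u a ∈ℤ L u
        ≡⟨ cong (_∈ℤ L u) (transfer-switchingSet eq u a) ⟩
      negateIf (Vec.lookup X u xor Vec.lookup X r) a ∈ℤ L u ∎)
    where
    open ≡-Reasoning
    ur : rep u ≡ r
    ur = trans (sym (rep-cong cru)) rr
  ... | false | false | false with rep u ==ᶠ r in rur
  ...   | false = refl
  ...   | true = ⊥-elim (false≢true (trans (sym cru) (subst (λ t → conn t u ≡ true) (==ᶠ-sound rur) (conn-rep u))))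

  freeChoices≡β : ∀ r → unbalancedAt r ≡ false → rep r ≡ r → freeChoices componentSpec L r ≡ β r L
  freeChoices≡β r balanced rr with switchingSet-exists r balanced
  ... | X , eq , _ = sym (begin
      β r L
        ≡⟨ β-switchingSet r X eq ⟩
      count Q (switchedList X r)
        ≡⟨ switch-r ⟩
      count (Q ∘ negateIf (Vec.lookup X r)) (L r)
        ≡⟨ count-cong-∈ (L r) (λ a a∈ → all-cong (linkFits-componentSpec r X balanced rr eq a a∈) (allFin n)) ⟩
      freeChoices componentSpec L r ∎)
    where
    open ≡-Reasoning
    Q : ℤ → Bool
    Q a = all (λ v → not (conn r v) ∨ (a ∈ℤ switchedList X v)) (allFin n)
    switch-r : count Q (switchedList X r) ≡ count (Q ∘ negateIf (Vec.lookup X r)) (L r)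
    switch-r with Vec.lookup X r
    ... | true = count-map Q -_ (L r)
    ... | false = refl

  zeroAllowed : Fin n → Bool
  zeroAllowed v = not (unbalancedAt v) ∨ ((+ 0) ∈ℤ L v)

  βFactor : Fin n → ℕ
  βFactor r = if isRep r ∧ not (unbalancedAt r) then β r L else 1

  choices-componentSpec : ∀ v → choices componentSpec L v (componentSpec v) ≡ 𝟙 (zeroAllowed v) * βFactor v
  choices-componentSpec v with unbalancedAt v in ub | rep v ==ᶠ v in rv
  ... | true | _ rewrite ∧-zeroʳ (isRep v) = sym (ℕP.*-identityʳ _)
  ... | false | true rewrite isRep-rep v (==ᶠ-sound rv) =
    trans (freeChoices≡β v ub (==ᶠ-sound rv)) (sym (ℕP.+-identityʳ _))
  ... | false | false rewrite isRep-¬rep v rv = refl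

  count-violatesAll : (∀ v → Unique (L v)) → + count (violatesAll F) (assignments n L) ≡ γ L *ℤ prodβ L
  count-violatesAll unique = begin
      + count (violatesAll F) (assignments n L)
        ≡⟨ cong +_ (count-cong violatesAll≡meets (assignments n L)) ⟩
      + count (meets componentSpec) (assignments n L)
        ≡⟨ cong +_ (count-meets n L componentSpec unique componentSpec-LinksToEarlierFree) ⟩
      + choiceCount componentSpec L
        ≡⟨ cong +_ (cong product (map-cong choices-componentSpec (allFin n))) ⟩
      + product (map (λ v → 𝟙 (zeroAllowed v) * βFactor v) (allFin n))
        ≡⟨ cong +_ (product-𝟙-* zeroAllowed βFactor (allFin n)) ⟩
      + (𝟙 (all zeroAllowed (allFin n)) * product (map βFactor (allFin n)))
        ≡⟨ ℤP.pos-* (𝟙 (all zeroAllowed (allFin n))) (product (map βFactor (allFin n))) ⟩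
      + 𝟙 (all zeroAllowed (allFin n)) *ℤ + product (map βFactor (allFin n))
        ≡⟨ cong₂ _*ℤ_ (if-𝟙 (all zeroAllowed (allFin n))) prodβ≡ ⟨
      γ L *ℤ prodβ L ∎
    where
    open ≡-Reasoning
    prodβ≡ : prodβ L ≡ + product (map βFactor (allFin n))
    prodβ≡ = trans (cong prodℤ (map-cong (λ r → sym (if-float +_ (isRep r ∧ not (unbalancedAt r)))) (allFin n)))
                   (prodℤ-map-+ βFactor (allFin n))

lemma2p3 : ∀ {n m : ℕ} (Σ : SignedGraph n m) (L : Fin n → List ℤ) →
    (∀ v → L v ≢ []) → (∀ v → Unique (L v)) →
    + P Σ L ≡ expansion Σ L
lemma2p3 {n} {m} Σ L _ unique = begin
    + P Σ L
      ≡⟨ Violations.P-inclusion–exclusion Σ L ⟩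
    sumℤ (map (λ F → signPow (card F) *ℤ + count (Violations.violatesAll Σ F) (assignments n L)) (allSubsets m))
      ≡⟨ sumℤ-cong (λ F → cong (signPow (card F) *ℤ_) (Counting.count-violatesAll Σ F L unique)) (allSubsets m) ⟩
    expansion Σ L ∎
  where open ≡-Reasoning
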